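{- Let $D=(V,E,\psi)$ be a general $r$-regular digraph with $n$ vertices and $m$ arcs. Then, as an identity of rational functions in $\lambda$, $$A(\lambda , D^{+01}) = \lambda^{m-1} (\lambda^2 - r\lambda - m n )(\lambda - r)^{ -1} A(\lambda, D).$$
   Context: A general digraph is $D=(V,E,\psi)$ with $V$ finite nonempty, $E$ a finite arc set disjoint from $V$, and $\psi:E\to V\times V$ (loops and multiple arcs allowed); for $\psi(e)=(u,v)$, $t(e)=u$, $h(e)=v$. $D$ is $r$-regular if for every vertex $v$ the number of arcs with tail $v$ and the number of arcs with head $v$ are both $r$. The adjacency matrix $A(G)$ has $(u,v)$ entry equal to the number of arcs from $u$ to $v$; $A(\lambda,G)=\det(\lambda I-A(G))$. $D^{+01}$ is the digraph with vertex set $V\cup E$ whose arcs are the arcs of $D$ (on $V$) together with all arcs $(v,e)$ and $(e,v)$ for $v\in V$, $e\in E$ (and no arcs between vertices of $E$). -}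

module Defs where

open import Data.Nat as ℕ using (ℕ; zero; suc; _≤_)
open import Data.Nat.Properties using (≤-trans; m≤m+n)
open import Data.Integer as ℤ using (ℤ; +_; -_)
open import Data.Fin as Fin using (Fin; zero; suc; toℕ; _↑ˡ_; _↑ʳ_; splitAt; remQuot; punchIn)
open import Data.Fin.Properties using () renaming (_≟_ to _≟F_)
open import Data.Product using (_×_; _,_; proj₁; proj₂)
open import Data.Sum using (inj₁; inj₂)
open import Data.Bool using (Bool; true; false; if_then_else_; _∧_)
open import Data.List using (List; []; _∷_; map)
open import Relation.Nullary using (does)
open import Relation.Binary.PropositionalEquality using (_≡_)

-- Univariate polynomials over ℤ in the indeterminate λ:
-- a list of coefficients, index k holds the coefficient of λ^k.

Poly : Set
Poly = List ℤ

infixl 6 _+P_ _-P_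
infixl 7 _*P_ _·P_

_+P_ : Poly → Poly → Poly
[] +P q = q
(a ∷ p) +P [] = a ∷ p
(a ∷ p) +P (b ∷ q) = (a ℤ.+ b) ∷ (p +P q)

_·P_ : ℤ → Poly → Poly
a ·P p = map (a ℤ.*_) p

-P_ : Poly → Poly
-P p = map -_ p

_-P_ : Poly → Poly → Poly
p -P q = p +P (-P q)

_*P_ : Poly → Poly → Poly
[] *P q = []
(a ∷ p) *P q = (a ·P q) +P (+ 0 ∷ (p *P q))

constP : ℤ → Poly
constP c = c ∷ []

X : Poly
X = + 0 ∷ + 1 ∷ []

_^P_ : Poly → ℕ → Poly
p ^P zero = constP (+ 1)
p ^P suc k = p *P (p ^P k)

coeff : Poly → ℕ → ℤ
coeff [] k = + 0
coeff (a ∷ p) zero = a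
coeff (a ∷ p) (suc k) = coeff p k

infix 4 _≈P_
_≈P_ : Poly → Poly → Set
p ≈P q = ∀ k → coeff p k ≡ coeff q k

sumP : ∀ k → (Fin k → Poly) → Poly
sumP zero f = []
sumP (suc k) f = f zero +P sumP k (λ j → f (suc j))

signP : ℕ → Poly
signP zero = constP (+ 1)
signP (suc i) = -P signP i

det : ∀ k → (Fin k → Fin k → Poly) → Poly
det zero M = constP (+ 1)
det (suc k) M =
  sumP (suc k) (λ j → signP (toℕ j) *P M zero j *P
                      det k (λ a b → M (suc a) (punchIn j b)))

charPolyMat : ∀ k → (Fin k → Fin k → ℤ) → Poly
charPolyMat k A =
  det k (λ i j → (if does (i ≟F j) then X else []) +P constP (- A i j))

-- General digraphs: vertex set Fin n (nonempty), arc set Fin m,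
-- incidence ψ : arcs → V × V (loops and multiple arcs allowed).

record Digraph : Set where
  field
    n : ℕ
    m : ℕ
    nonempty : 1 ≤ n
    ψ : Fin m → Fin n × Fin n

  tl : Fin m → Fin n
  tl e = proj₁ (ψ e)

  hd : Fin m → Fin n
  hd e = proj₂ (ψ e)

count : ∀ k → (Fin k → Bool) → ℕ
count zero P = 0
count (suc k) P = (if P zero then 1 else 0) ℕ.+ count k (λ j → P (suc j))

module _ (D : Digraph) where
  open Digraph D

  outdeg : Fin n → ℕ
  outdeg v = count m (λ e → does (tl e ≟F v))

  indeg : Fin n → ℕ
  indeg v = count m (λ e → does (hd e ≟F v))

  adj : Fin n → Fin n → ℤ
  adj u v = + count m (λ e → does (tl e ≟F u) ∧ does (hd e ≟F v))

  charPoly : Poly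
  charPoly = charPolyMat n adj

IsRegular : Digraph → ℕ → Set
IsRegular D r = ∀ v → outdeg D v ≡ r × indeg D v ≡ r

-- D^{+01}: vertex set V ∪ E, encoded as Fin (n + m) (vertices v ↦ v ↑ˡ m,
-- arcs e ↦ n ↑ʳ e).  Arc set: the m arcs of D, then the n*m arcs (v,e),
-- then the n*m arcs (e,v).
plus01 : Digraph → Digraph
plus01 D = record
  { n = n ℕ.+ m
  ; m = m ℕ.+ (n ℕ.* m ℕ.+ n ℕ.* m)
  ; nonempty = ≤-trans nonempty (m≤m+n n m)
  ; ψ = ψ'
  }
  where
  open Digraph D
  vtx : Fin n → Fin (n ℕ.+ m)
  vtx v = v ↑ˡ m
  arc : Fin m → Fin (n ℕ.+ m)
  arc e = n ↑ʳ e
  ψ' : Fin (m ℕ.+ (n ℕ.* m ℕ.+ n ℕ.* m)) → Fin (n ℕ.+ m) × Fin (n ℕ.+ m)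
  ψ' a with splitAt m a
  ... | inj₁ e = vtx (tl e) , vtx (hd e)
  ... | inj₂ b with splitAt (n ℕ.* m) b
  ...   | inj₁ c = vtx (proj₁ (remQuot {n} m c)) , arc (proj₂ (remQuot {n} m c))
  ...   | inj₂ c = arc (proj₂ (remQuot {n} m c)) , vtx (proj₁ (remQuot {n} m c))

module Submission where

-- In ℤ[λ],   λ(λ - r) · A(λ, D^{+01}) = λ^m (λ² - rλ - mn) · A(λ, D),
-- the paper's identity of rational functions with its denominator cleared.
--
-- Index the vertices of D^{+01} by V ⊎ E.  Then λI - A(D^{+01}) is the
-- bordered matrix [[B, -J], [-J, λI]] with B = λI - A(D).  Scaling the rows
-- of V by λ and subtracting the rows of E (a Schur complement) gives
--     λ^n · det [[B, -J], [-J, λI]] = λ^m · det (λB - mJ),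
-- and since every column of B sums to s = λ - r, adding all rows of λB - mJ
-- to the first one and clearing the others again gives
--     s · det (λB - mJ) = λ^(n-1) (λs - nm) · det B.
-- Multiplying by λs and cancelling λ^n proves the theorem.

open import Defs
open import Data.Nat using (ℕ)
open import Data.Integer using (+_)
open import Algebra.Bundles using (CommutativeMonoid; CommutativeRing; Semiring)
import Algebra.Solver.CommutativeMonoid
open import Data.Bool using (Bool; true; false; if_then_else_; _∧_)
open import Data.Bool.Properties using (∧-zeroʳ; ∧-comm)
open import Data.Empty using (⊥-elim)
open import Data.Fin as Fin using (Fin; zero; suc; toℕ; punchIn; punchOut; _↑ˡ_; _↑ʳ_; splitAt; join; remQuot; combine)
open import Data.Fin.Properties using (punchInᵢ≢i; punchOut-punchIn; punchOut-cong; suc-injective; toℕ-injective;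
  toℕ<n; toℕ-fromℕ<; toℕ-↑ˡ; splitAt-↑ˡ; splitAt-↑ʳ; splitAt-join; join-splitAt; remQuot-combine; combine-remQuot)
  renaming (_≟_ to _≟F_)
import Data.Integer as ℤ
import Data.Integer.Properties as ℤP
open import Data.Integer.Tactic.RingSolver using (solve-∀)
open import Data.List using ([]; _∷_)
open import Data.Nat as ℕ using (zero; suc; _<_; _≤_; _<?_; s≤s)
import Data.Nat.Properties as ℕP
open import Data.Nat.Properties using (≤-refl; ≤-pred; ≤-reflexive; <-irrefl; ≤∧≢⇒<; m<n⇒m<1+n; <⇒≤)
open import Data.Product using (_×_; _,_; proj₁; proj₂)
open import Data.Sum using (_⊎_; inj₁; inj₂; map₂)
open import Data.Sum.Properties using (≡-dec)
open import Function using (_∘_)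
open import Level using (_⊔_)
open import Relation.Binary.Definitions using (DecidableEquality)
open import Relation.Binary.PropositionalEquality as ≡ using (_≡_; _≢_)
open import Relation.Nullary using (Dec; yes; no; does; ¬_)
open import Relation.Nullary.Decidable using (dec-true; dec-false)

-- A ring has no 2-torsion if x + x ≈ 0 forces x ≈ 0.  This is what makes
-- the alternation argument below work: det M = - det M forces det M = 0.
NoTwoTorsion : ∀ {c ℓ} → CommutativeRing c ℓ → Set (c ⊔ ℓ)
NoTwoTorsion R = ∀ x → x + x ≈ 0# → x ≈ 0#
  where open CommutativeRing R

module FinSums {c ℓ} (M : CommutativeMonoid c ℓ) where

  open CommutativeMonoid M renaming (_∙_ to _+_; ε to 0#)
  open import Algebra.Properties.CommutativeMonoid.Sum M public
    using (sum; sum-syntax; sum-cong-≋; sum-cong-≗; sum-remove; sum-replicate; sum-replicate-zero; ∑-distrib-+; ∑-comm)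
  open import Relation.Binary.Reasoning.Setoid setoid

  sum-zero : ∀ {n} (f : Fin n → Carrier) → (∀ i → f i ≈ 0#) → sum f ≈ 0#
  sum-zero {n} f f≈0 = trans (sum-cong-≋ f≈0) (sum-replicate-zero n)

  sum-single : ∀ {n} (f : Fin n → Carrier) j → (∀ i → i ≢ j → f i ≈ 0#) → sum f ≈ f j
  sum-single {suc n} f j f≈0 = begin
    sum f                             ≈⟨ sum-remove f ⟩
    f j + sum (λ k → f (punchIn j k)) ≈⟨ ∙-congˡ (sum-zero _ (λ k → f≈0 (punchIn j k) (punchInᵢ≢i j k))) ⟩
    f j + 0#                          ≈⟨ identityʳ (f j) ⟩
    f j                               ∎

  sum-split : ∀ n {m} (f : Fin (n ℕ.+ m) → Carrier) →
              sum f ≈ sum (λ i → f (i ↑ˡ m)) + sum (λ e → f (n ↑ʳ e))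
  sum-split zero    f = sym (identityˡ _)
  sum-split (suc n) f = trans (∙-congˡ (sum-split n (f ∘ suc))) (sym (assoc _ _ _))

-- Every law is proved coefficientwise: addition, scaling and
-- negation act on coefficients directly, and multiplication satisfies
-- coeff ((a ∷ p) * q) = a * coeff q + coeff (λ * (p * q)).
module Polynomials where

  open ℤ using (-_)
  open ≡ using (refl; sym; trans; cong; cong₂; module ≡-Reasoning)
  open ≡-Reasoning

  coeff-+ : ∀ p q k → coeff (p +P q) k ≡ coeff p k ℤ.+ coeff q k
  coeff-+ []      q       k       = sym (ℤP.+-identityˡ _)
  coeff-+ (a ∷ p) []      k       = sym (ℤP.+-identityʳ _)
  coeff-+ (a ∷ p) (b ∷ q) zero    = refl
  coeff-+ (a ∷ p) (b ∷ q) (suc k) = coeff-+ p q k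

  coeff-· : ∀ a p k → coeff (a ·P p) k ≡ a ℤ.* coeff p k
  coeff-· a []      k       = sym (ℤP.*-zeroʳ a)
  coeff-· a (b ∷ p) zero    = refl
  coeff-· a (b ∷ p) (suc k) = coeff-· a p k

  coeff-neg : ∀ p k → coeff (-P p) k ≡ - coeff p k
  coeff-neg []      k       = refl
  coeff-neg (b ∷ p) zero    = refl
  coeff-neg (b ∷ p) (suc k) = coeff-neg p k

  shift : Poly → Poly
  shift p = + 0 ∷ p

  coeff-shift-[] : ∀ k → coeff (shift []) k ≡ + 0
  coeff-shift-[] zero    = refl
  coeff-shift-[] (suc k) = refl

  coeff-shift-· : ∀ a p k → coeff (shift (a ·P p)) k ≡ a ℤ.* coeff (shift p) k
  coeff-shift-· a p zero    = sym (ℤP.*-zeroʳ a)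
  coeff-shift-· a p (suc k) = coeff-· a p k

  coeff-shift-+ : ∀ p q k → coeff (shift (p +P q)) k ≡ coeff (shift p) k ℤ.+ coeff (shift q) k
  coeff-shift-+ p q zero    = refl
  coeff-shift-+ p q (suc k) = coeff-+ p q k

  coeff-* : ∀ a p q k → coeff ((a ∷ p) *P q) k ≡ a ℤ.* coeff q k ℤ.+ coeff (shift (p *P q)) k
  coeff-* a p q k = trans (coeff-+ (a ·P q) (shift (p *P q)) k)
                          (cong (ℤ._+ coeff (shift (p *P q)) k) (coeff-· a q k))

  shift-cong : ∀ {p q} → p ≈P q → shift p ≈P shift q
  shift-cong e zero    = refl
  shift-cong e (suc k) = e k

  +P-cong : ∀ {p p′ q q′} → p ≈P p′ → q ≈P q′ → p +P q ≈P p′ +P q′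
  +P-cong {p} {p′} {q} {q′} e f k = begin
    coeff (p +P q) k          ≡⟨ coeff-+ p q k ⟩
    coeff p k ℤ.+ coeff q k   ≡⟨ cong₂ ℤ._+_ (e k) (f k) ⟩
    coeff p′ k ℤ.+ coeff q′ k ≡⟨ coeff-+ p′ q′ k ⟨
    coeff (p′ +P q′) k        ∎

  -P-cong : ∀ {p q} → p ≈P q → -P p ≈P -P q
  -P-cong {p} {q} e k = trans (coeff-neg p k) (trans (cong -_ (e k)) (sym (coeff-neg q k)))

  vanishing-term : ∀ q k → + 0 ℤ.* coeff q k ℤ.+ coeff (shift []) k ≡ + 0
  vanishing-term q k = cong₂ ℤ._+_ (ℤP.*-zeroˡ (coeff q k)) (coeff-shift-[] k)

  -- the cases [] versus (b ∷ p′) are needed since a list of zeros is ≈P []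
  *P-congˡ : ∀ {p p′} q → p ≈P p′ → p *P q ≈P p′ *P q
  *P-congˡ {[]}    {[]}     q e k = refl
  *P-congˡ {a ∷ p} {b ∷ p′} q e k = begin
    coeff ((a ∷ p) *P q) k                        ≡⟨ coeff-* a p q k ⟩
    a ℤ.* coeff q k ℤ.+ coeff (shift (p *P q)) k  ≡⟨ cong₂ ℤ._+_ (cong (ℤ._* coeff q k) (e 0))
                                                       (shift-cong {p *P q} {p′ *P q} (*P-congˡ {p} {p′} q (λ i → e (suc i))) k) ⟩
    b ℤ.* coeff q k ℤ.+ coeff (shift (p′ *P q)) k ≡⟨ coeff-* b p′ q k ⟨
    coeff ((b ∷ p′) *P q) k                       ∎
  *P-congˡ {[]}    {b ∷ p′} q e k = begin
    + 0                                           ≡⟨ vanishing-term q k ⟨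
    + 0 ℤ.* coeff q k ℤ.+ coeff (shift []) k      ≡⟨ cong₂ ℤ._+_ (cong (ℤ._* coeff q k) (e 0))
                                                       (shift-cong {[]} {p′ *P q} (*P-congˡ {[]} {p′} q (λ i → e (suc i))) k) ⟩
    b ℤ.* coeff q k ℤ.+ coeff (shift (p′ *P q)) k ≡⟨ coeff-* b p′ q k ⟨
    coeff ((b ∷ p′) *P q) k                       ∎
  *P-congˡ {a ∷ p} {[]}     q e k = begin
    coeff ((a ∷ p) *P q) k                       ≡⟨ coeff-* a p q k ⟩
    a ℤ.* coeff q k ℤ.+ coeff (shift (p *P q)) k ≡⟨ cong₂ ℤ._+_ (cong (ℤ._* coeff q k) (e 0))
                                                      (shift-cong {p *P q} {[]} (*P-congˡ {p} {[]} q (λ i → e (suc i))) k) ⟩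
    + 0 ℤ.* coeff q k ℤ.+ coeff (shift []) k     ≡⟨ vanishing-term q k ⟩
    + 0                                          ∎

  +P-comm : ∀ p q → p +P q ≈P q +P p
  +P-comm p q k = begin
    coeff (p +P q) k        ≡⟨ coeff-+ p q k ⟩
    coeff p k ℤ.+ coeff q k ≡⟨ ℤP.+-comm (coeff p k) (coeff q k) ⟩
    coeff q k ℤ.+ coeff p k ≡⟨ coeff-+ q p k ⟨
    coeff (q +P p) k        ∎

  +P-assoc : ∀ p q s → (p +P q) +P s ≈P p +P (q +P s)
  +P-assoc p q s k = begin
    coeff ((p +P q) +P s) k                 ≡⟨ coeff-+ (p +P q) s k ⟩
    coeff (p +P q) k ℤ.+ coeff s k          ≡⟨ cong (ℤ._+ coeff s k) (coeff-+ p q k) ⟩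
    coeff p k ℤ.+ coeff q k ℤ.+ coeff s k   ≡⟨ ℤP.+-assoc (coeff p k) _ _ ⟩
    coeff p k ℤ.+ (coeff q k ℤ.+ coeff s k) ≡⟨ cong (λ z → coeff p k ℤ.+ z) (coeff-+ q s k) ⟨
    coeff p k ℤ.+ coeff (q +P s) k          ≡⟨ coeff-+ p (q +P s) k ⟨
    coeff (p +P (q +P s)) k                 ∎

  +P-identityʳ : ∀ p → p +P [] ≈P p
  +P-identityʳ p k = trans (coeff-+ p [] k) (ℤP.+-identityʳ _)

  +P-inverseˡ : ∀ p → (-P p) +P p ≈P []
  +P-inverseˡ p k = begin
    coeff (-P p +P p) k          ≡⟨ coeff-+ (-P p) p k ⟩
    coeff (-P p) k ℤ.+ coeff p k ≡⟨ cong (ℤ._+ coeff p k) (coeff-neg p k) ⟩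
    - coeff p k ℤ.+ coeff p k    ≡⟨ ℤP.+-inverseˡ (coeff p k) ⟩
    + 0                          ∎

  +P-inverseʳ : ∀ p → p +P (-P p) ≈P []
  +P-inverseʳ p k = trans (+P-comm p (-P p) k) (+P-inverseˡ p k)

  *P-consʳ : ∀ p b q → p *P (b ∷ q) ≈P b ·P p +P shift (p *P q)
  *P-consʳ []      b q zero    = refl
  *P-consʳ []      b q (suc k) = refl
  *P-consʳ (a ∷ p) b q zero    = begin
    a ℤ.* b ℤ.+ + 0                                   ≡⟨ cong (ℤ._+ + 0) (ℤP.*-comm a b) ⟩
    b ℤ.* a ℤ.+ + 0                                   ≡⟨ coeff-+ (b ·P (a ∷ p)) (shift ((a ∷ p) *P q)) zero ⟨
    coeff (b ·P (a ∷ p) +P shift ((a ∷ p) *P q)) zero ∎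
  *P-consʳ (a ∷ p) b q (suc k) = begin
    coeff ((a ∷ p) *P (b ∷ q)) (suc k)
      ≡⟨ coeff-* a p (b ∷ q) (suc k) ⟩
    a ℤ.* coeff q k ℤ.+ coeff (p *P (b ∷ q)) k
      ≡⟨ cong (λ z → a ℤ.* coeff q k ℤ.+ z) (*P-consʳ p b q k) ⟩
    a ℤ.* coeff q k ℤ.+ coeff (b ·P p +P shift (p *P q)) k
      ≡⟨ cong (λ z → a ℤ.* coeff q k ℤ.+ z) (trans (coeff-+ (b ·P p) _ k) (cong (ℤ._+ _) (coeff-· b p k))) ⟩
    a ℤ.* coeff q k ℤ.+ (b ℤ.* coeff p k ℤ.+ coeff (shift (p *P q)) k)
      ≡⟨ swap (a ℤ.* coeff q k) (b ℤ.* coeff p k) _ ⟩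
    b ℤ.* coeff p k ℤ.+ (a ℤ.* coeff q k ℤ.+ coeff (shift (p *P q)) k)
      ≡⟨ cong₂ ℤ._+_ (coeff-· b p k) (coeff-* a p q k) ⟨
    coeff (b ·P p) k ℤ.+ coeff ((a ∷ p) *P q) k
      ≡⟨ coeff-+ (b ·P (a ∷ p)) (shift ((a ∷ p) *P q)) (suc k) ⟨
    coeff (b ·P (a ∷ p) +P shift ((a ∷ p) *P q)) (suc k) ∎
    where
    swap : ∀ x y z → x ℤ.+ (y ℤ.+ z) ≡ y ℤ.+ (x ℤ.+ z)
    swap = solve-∀

  *P-zeroʳ : ∀ p → p *P [] ≈P []
  *P-zeroʳ []      k       = refl
  *P-zeroʳ (a ∷ p) zero    = refl
  *P-zeroʳ (a ∷ p) (suc k) = *P-zeroʳ p k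

  *P-comm : ∀ p q → p *P q ≈P q *P p
  *P-comm []      q k = sym (*P-zeroʳ q k)
  *P-comm (a ∷ p) q k = begin
    coeff ((a ∷ p) *P q) k                        ≡⟨ coeff-* a p q k ⟩
    a ℤ.* coeff q k ℤ.+ coeff (shift (p *P q)) k  ≡⟨ cong₂ ℤ._+_ (coeff-· a q k) (shift-cong (*P-comm q p) k) ⟨
    coeff (a ·P q) k ℤ.+ coeff (shift (q *P p)) k ≡⟨ coeff-+ (a ·P q) (shift (q *P p)) k ⟨
    coeff (a ·P q +P shift (q *P p)) k            ≡⟨ *P-consʳ q a p k ⟨
    coeff (q *P (a ∷ p)) k                        ∎

  ·P-*P-assoc : ∀ a p q → (a ·P p) *P q ≈P a ·P (p *P q)
  ·P-*P-assoc a []      q k = trans (sym (ℤP.*-zeroʳ a)) (sym (coeff-· a [] k))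
  ·P-*P-assoc a (b ∷ p) q k = begin
    coeff ((a ℤ.* b ∷ a ·P p) *P q) k                         ≡⟨ coeff-* (a ℤ.* b) (a ·P p) q k ⟩
    a ℤ.* b ℤ.* coeff q k ℤ.+ coeff (shift ((a ·P p) *P q)) k ≡⟨ cong (λ z → a ℤ.* b ℤ.* coeff q k ℤ.+ z)
                                                                  (trans (shift-cong (·P-*P-assoc a p q) k) (coeff-shift-· a (p *P q) k)) ⟩
    a ℤ.* b ℤ.* coeff q k ℤ.+ a ℤ.* coeff (shift (p *P q)) k  ≡⟨ factor a b (coeff q k) _ ⟩
    a ℤ.* (b ℤ.* coeff q k ℤ.+ coeff (shift (p *P q)) k)      ≡⟨ cong (a ℤ.*_) (coeff-* b p q k) ⟨
    a ℤ.* coeff ((b ∷ p) *P q) k                              ≡⟨ coeff-· a ((b ∷ p) *P q) k ⟨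
    coeff (a ·P ((b ∷ p) *P q)) k                             ∎
    where
    factor : ∀ a b c d → a ℤ.* b ℤ.* c ℤ.+ a ℤ.* d ≡ a ℤ.* (b ℤ.* c ℤ.+ d)
    factor = solve-∀

  shift-*P : ∀ p q → shift p *P q ≈P shift (p *P q)
  shift-*P p q k = begin
    coeff (shift p *P q) k                         ≡⟨ coeff-* (+ 0) p q k ⟩
    + 0 ℤ.* coeff q k ℤ.+ coeff (shift (p *P q)) k ≡⟨ cong (ℤ._+ coeff (shift (p *P q)) k) (ℤP.*-zeroˡ (coeff q k)) ⟩
    + 0 ℤ.+ coeff (shift (p *P q)) k               ≡⟨ ℤP.+-identityˡ _ ⟩
    coeff (shift (p *P q)) k                       ∎

  *P-distribʳ : ∀ p p′ q → (p +P p′) *P q ≈P p *P q +P p′ *P q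
  *P-distribʳ []      p′       q k = refl
  *P-distribʳ (a ∷ p) []       q k = sym (+P-identityʳ ((a ∷ p) *P q) k)
  *P-distribʳ (a ∷ p) (b ∷ p′) q k = begin
    coeff ((a ℤ.+ b ∷ p +P p′) *P q) k
      ≡⟨ coeff-* (a ℤ.+ b) (p +P p′) q k ⟩
    (a ℤ.+ b) ℤ.* coeff q k ℤ.+ coeff (shift ((p +P p′) *P q)) k
      ≡⟨ cong (λ z → (a ℤ.+ b) ℤ.* coeff q k ℤ.+ z)
              (trans (shift-cong (*P-distribʳ p p′ q) k) (coeff-shift-+ (p *P q) (p′ *P q) k)) ⟩
    (a ℤ.+ b) ℤ.* coeff q k ℤ.+ (coeff (shift (p *P q)) k ℤ.+ coeff (shift (p′ *P q)) k)
      ≡⟨ regroup a b (coeff q k) _ _ ⟩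
    (a ℤ.* coeff q k ℤ.+ coeff (shift (p *P q)) k) ℤ.+ (b ℤ.* coeff q k ℤ.+ coeff (shift (p′ *P q)) k)
      ≡⟨ cong₂ ℤ._+_ (coeff-* a p q k) (coeff-* b p′ q k) ⟨
    coeff ((a ∷ p) *P q) k ℤ.+ coeff ((b ∷ p′) *P q) k
      ≡⟨ coeff-+ ((a ∷ p) *P q) ((b ∷ p′) *P q) k ⟨
    coeff ((a ∷ p) *P q +P (b ∷ p′) *P q) k ∎
    where
    regroup : ∀ a b c x y → (a ℤ.+ b) ℤ.* c ℤ.+ (x ℤ.+ y) ≡ (a ℤ.* c ℤ.+ x) ℤ.+ (b ℤ.* c ℤ.+ y)
    regroup = solve-∀

  *P-assoc : ∀ p q s → (p *P q) *P s ≈P p *P (q *P s)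
  *P-assoc []      q s k = refl
  *P-assoc (a ∷ p) q s k = begin
    coeff ((a ·P q +P shift (p *P q)) *P s) k
      ≡⟨ *P-distribʳ (a ·P q) (shift (p *P q)) s k ⟩
    coeff ((a ·P q) *P s +P shift (p *P q) *P s) k
      ≡⟨ coeff-+ ((a ·P q) *P s) (shift (p *P q) *P s) k ⟩
    coeff ((a ·P q) *P s) k ℤ.+ coeff (shift (p *P q) *P s) k
      ≡⟨ cong₂ ℤ._+_ (·P-*P-assoc a q s k)
                     (trans (shift-*P (p *P q) s k) (shift-cong (*P-assoc p q s) k)) ⟩
    coeff (a ·P (q *P s)) k ℤ.+ coeff (shift (p *P (q *P s))) k
      ≡⟨ coeff-+ (a ·P (q *P s)) (shift (p *P (q *P s))) k ⟨
    coeff ((a ∷ p) *P (q *P s)) k ∎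

  *P-identityˡ : ∀ p → constP (+ 1) *P p ≈P p
  *P-identityˡ p k = begin
    coeff (constP (+ 1) *P p) k              ≡⟨ coeff-* (+ 1) [] p k ⟩
    + 1 ℤ.* coeff p k ℤ.+ coeff (shift []) k ≡⟨ cong₂ ℤ._+_ (ℤP.*-identityˡ (coeff p k)) (coeff-shift-[] k) ⟩
    coeff p k ℤ.+ + 0                        ≡⟨ ℤP.+-identityʳ _ ⟩
    coeff p k                                ∎

  *P-cong : ∀ {p p′ q q′} → p ≈P p′ → q ≈P q′ → p *P q ≈P p′ *P q′
  *P-cong {p} {p′} {q} {q′} e f k = begin
    coeff (p *P q) k   ≡⟨ *P-congˡ {p} {p′} q e k ⟩
    coeff (p′ *P q) k  ≡⟨ *P-comm p′ q k ⟩
    coeff (q *P p′) k  ≡⟨ *P-congˡ {q} {q′} p′ f k ⟩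
    coeff (q′ *P p′) k ≡⟨ *P-comm q′ p′ k ⟩
    coeff (p′ *P q′) k ∎

  *P-identityʳ : ∀ p → p *P constP (+ 1) ≈P p
  *P-identityʳ p k = trans (*P-comm p (constP (+ 1)) k) (*P-identityˡ p k)

  *P-distribˡ : ∀ p q s → p *P (q +P s) ≈P p *P q +P p *P s
  *P-distribˡ p q s k = begin
    coeff (p *P (q +P s)) k    ≡⟨ *P-comm p (q +P s) k ⟩
    coeff ((q +P s) *P p) k    ≡⟨ *P-distribʳ q s p k ⟩
    coeff (q *P p +P s *P p) k ≡⟨ +P-cong {q *P p} {p *P q} {s *P p} {p *P s} (*P-comm q p) (*P-comm s p) k ⟩
    coeff (p *P q +P p *P s) k ∎

  +P-constP-0 : ∀ p → p +P constP (+ 0) ≈P p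
  +P-constP-0 p k = trans (coeff-+ p (constP (+ 0)) k) (trans (cong (λ z → coeff p k ℤ.+ z) (coeff-0 k)) (ℤP.+-identityʳ _))
    where
    coeff-0 : ∀ k → coeff (constP (+ 0)) k ≡ + 0
    coeff-0 zero    = refl
    coeff-0 (suc k) = refl

  -- _≈P_ is a function type, from which Agda cannot recover the two
  -- polynomials; the ring uses this record wrapper so that they stay inferable.
  infix 4 _≋_
  record _≋_ (p q : Poly) : Set where
    constructor mk≋
    field coeffs : p ≈P q
  open _≋_ public

  polyRing : CommutativeRing _ _
  polyRing = record
    { Carrier = Poly ; _≈_ = _≋_ ; _+_ = _+P_ ; _*_ = _*P_ ; -_ = -P_
    ; 0# = [] ; 1# = constP (+ 1)
    ; isCommutativeRing = record
      { isRing = record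
        { +-isAbelianGroup = record
          { isGroup = record
            { isMonoid = record
              { isSemigroup = record
                { isMagma = record
                  { isEquivalence = record
                    { refl = mk≋ (λ k → refl)
                    ; sym = λ e → mk≋ (λ k → sym (coeffs e k))
                    ; trans = λ e f → mk≋ (λ k → trans (coeffs e k) (coeffs f k)) }
                  ; ∙-cong = λ {p} {p′} {q} {q′} e f → mk≋ (+P-cong {p} {p′} {q} {q′} (coeffs e) (coeffs f)) }
                ; assoc = λ p q s → mk≋ (+P-assoc p q s) }
              ; identity = (λ p → mk≋ (λ k → refl)) , (λ p → mk≋ (+P-identityʳ p)) }
            ; inverse = (λ p → mk≋ (+P-inverseˡ p)) , (λ p → mk≋ (+P-inverseʳ p))
            ; ⁻¹-cong = λ {p} {q} e → mk≋ (-P-cong {p} {q} (coeffs e)) }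
          ; comm = λ p q → mk≋ (+P-comm p q) }
        ; *-cong = λ {p} {p′} {q} {q′} e f → mk≋ (*P-cong {p} {p′} {q} {q′} (coeffs e) (coeffs f))
        ; *-assoc = λ p q s → mk≋ (*P-assoc p q s)
        ; *-identity = (λ p → mk≋ (*P-identityˡ p)) , (λ p → mk≋ (*P-identityʳ p))
        ; distrib = (λ p q s → mk≋ (*P-distribˡ p q s)) , (λ p q s → mk≋ (*P-distribʳ q s p)) }
      ; *-comm = λ p q → mk≋ (*P-comm p q) } }

  no-two-torsion : NoTwoTorsion polyRing
  no-two-torsion p (mk≋ p+p≈0) = mk≋ λ k → ℤP.*-cancelˡ-≡ (+ 2) (coeff p k) (+ 0) (begin
    + 2 ℤ.* coeff p k       ≡⟨ double (coeff p k) ⟨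
    coeff p k ℤ.+ coeff p k ≡⟨ coeff-+ p p k ⟨
    coeff (p +P p) k        ≡⟨ p+p≈0 k ⟩
    + 0                     ∎)
    where
    double : ∀ x → x ℤ.+ x ≡ + 2 ℤ.* x
    double = solve-∀

  -- multiplication by λ^j shifts coefficients up by j, so it can be cancelled
  coeff-X* : ∀ p k → coeff (X *P p) (suc k) ≡ coeff p k
  coeff-X* p k = begin
    coeff (X *P p) (suc k)                                  ≡⟨ coeff-* (+ 0) (constP (+ 1)) p (suc k) ⟩
    + 0 ℤ.* coeff p (suc k) ℤ.+ coeff (constP (+ 1) *P p) k ≡⟨ cong₂ ℤ._+_ (ℤP.*-zeroˡ (coeff p (suc k))) (*P-identityˡ p k) ⟩
    + 0 ℤ.+ coeff p k                                       ≡⟨ ℤP.+-identityˡ (coeff p k) ⟩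
    coeff p k                                               ∎

  coeff-X^* : ∀ j p k → coeff ((X ^P j) *P p) (j ℕ.+ k) ≡ coeff p k
  coeff-X^* zero    p k = *P-identityˡ p k
  coeff-X^* (suc j) p k = begin
    coeff ((X *P (X ^P j)) *P p) (suc j ℕ.+ k)   ≡⟨ *P-assoc X (X ^P j) p (suc (j ℕ.+ k)) ⟩
    coeff (X *P ((X ^P j) *P p)) (suc (j ℕ.+ k)) ≡⟨ coeff-X* ((X ^P j) *P p) (j ℕ.+ k) ⟩
    coeff ((X ^P j) *P p) (j ℕ.+ k)              ≡⟨ coeff-X^* j p k ⟩
    coeff p k                                    ∎

  X^-cancel : ∀ j p q → (X ^P j) *P p ≋ (X ^P j) *P q → p ≋ q
  X^-cancel j p q (mk≋ eq) = mk≋ λ k → begin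
    coeff p k                       ≡⟨ coeff-X^* j p k ⟨
    coeff ((X ^P j) *P p) (j ℕ.+ k) ≡⟨ eq (j ℕ.+ k) ⟩
    coeff ((X ^P j) *P q) (j ℕ.+ k) ≡⟨ coeff-X^* j q k ⟩
    coeff q k                       ∎

module Determinants {r ℓ} (R : CommutativeRing r ℓ) (noTwoTorsion : NoTwoTorsion R) where

  open CommutativeRing R renaming (Carrier to A) hiding (zero)
  open import Algebra.Properties.Ring ring using (-‿distribˡ-*; -‿distribʳ-*; -1*x≈-x)
  open import Algebra.Properties.AbelianGroup +-abelianGroup using (⁻¹-involutive; ε⁻¹≈ε)
  open import Algebra.Properties.Semiring.Sum semiring using (*-distribˡ-sum; *-distribʳ-sum)
  open import Algebra.Definitions.RawSemiring (Semiring.rawSemiring semiring) public using (_^_)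
  open FinSums +-commutativeMonoid public
  -- Π.sum is the finite product ∏
  module Π = FinSums *-commutativeMonoid
  module ∙-Solver = Algebra.Solver.CommutativeMonoid *-commutativeMonoid
  open ∙-Solver using () renaming (_⊕_ to _·_)
  open import Relation.Binary.Reasoning.Setoid setoid

  sum-neg : ∀ {n} (f : Fin n → A) → - sum f ≈ ∑[ i < n ] (- f i)
  sum-neg f = begin
    - sum f                 ≈⟨ -1*x≈-x (sum f) ⟨
    - 1# * sum f            ≈⟨ *-distribˡ-sum (- 1#) f ⟩
    ∑[ i < _ ] (- 1# * f i) ≈⟨ sum-cong-≋ (λ i → -1*x≈-x (f i)) ⟩
    ∑[ i < _ ] (- f i)      ∎

  Mat : ℕ → Set r
  Mat n = Fin n → Fin n → A

  sign : ℕ → A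
  sign zero    = 1#
  sign (suc i) = - sign i

  minor : ∀ {n} → Fin (suc n) → Mat (suc n) → Mat n
  minor j M a b = M (suc a) (punchIn j b)

  -- named apart from Defs.det, which is its instance at ℤ[λ] (see det≡detR)
  detR : ∀ n → Mat n → A
  detR zero    M = 1#
  detR (suc n) M = ∑[ j < suc n ] (sign (toℕ j) * M zero j * detR n (minor j M))

  det-cong : ∀ n {M N : Mat n} → (∀ i j → M i j ≈ N i j) → detR n M ≈ detR n N
  det-cong zero    M≈N = refl
  det-cong (suc n) M≈N = sum-cong-≋ λ j →
    *-cong (*-congˡ {sign (toℕ j)} (M≈N zero j)) (det-cong n (λ a b → M≈N (suc a) (punchIn j b)))

  -- Replacing row k.  Since does (suc a ≟ suc k) is does (a ≟ k), the
  -- minors of M [ suc k ]≔ x are definitionally minors with a replaced row.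
  infixl 6 _[_]≔_
  _[_]≔_ : ∀ {n} → Mat n → Fin n → (Fin n → A) → Mat n
  (M [ k ]≔ x) a b = if does (a ≟F k) then x b else M a b

  ≔-here : ∀ {n} (M : Mat n) k x b → (M [ k ]≔ x) k b ≡ x b
  ≔-here M k x b = ≡.cong (λ same → if same then x b else M k b) (dec-true (k ≟F k) ≡.refl)

  ≔-there : ∀ {n} (M : Mat n) k x {a} b → a ≢ k → (M [ k ]≔ x) a b ≡ M a b
  ≔-there M k x {a} b a≢k = ≡.cong (λ same → if same then x b else M a b) (dec-false (a ≟F k) a≢k)

  ≔-cong : ∀ {n} (M : Mat n) k {x y : Fin n → A} → (∀ b → x b ≈ y b) →
           ∀ a b → (M [ k ]≔ x) a b ≈ (M [ k ]≔ y) a b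
  ≔-cong M k x≈y a b with does (a ≟F k)
  ... | true  = x≈y b
  ... | false = refl

  -- Multilinearity in row k.  For k = 0 the expansion is linear in the
  -- first row; for k = suc k′ the replaced row passes into every minor.
  det-row-+ : ∀ n (M : Mat n) k (x y : Fin n → A) →
              detR n (M [ k ]≔ λ b → x b + y b) ≈ detR n (M [ k ]≔ x) + detR n (M [ k ]≔ y)
  det-row-+ (suc n) M zero x y = begin
    ∑[ j < suc n ] (sign (toℕ j) * (x j + y j) * d j)
      ≈⟨ sum-cong-≋ (λ j → expand (sign (toℕ j)) (x j) (y j) (d j)) ⟩
    ∑[ j < suc n ] (sign (toℕ j) * x j * d j + sign (toℕ j) * y j * d j)
      ≈⟨ ∑-distrib-+ (λ j → sign (toℕ j) * x j * d j) (λ j → sign (toℕ j) * y j * d j) ⟩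
    ∑[ j < suc n ] (sign (toℕ j) * x j * d j) + ∑[ j < suc n ] (sign (toℕ j) * y j * d j) ∎
    where
    d : Fin (suc n) → A
    d j = detR n (minor j M)
    expand : ∀ s x y d → s * (x + y) * d ≈ s * x * d + s * y * d
    expand s x y d = trans (*-congʳ (distribˡ s x y)) (distribʳ d (s * x) (s * y))
  det-row-+ (suc n) M (suc k) x y = begin
    ∑[ j < suc n ] (e j * detR n (minor j M [ k ]≔ λ b → x (punchIn j b) + y (punchIn j b)))
      ≈⟨ sum-cong-≋ (λ j → *-congˡ {e j} (det-row-+ n (minor j M) k (x ∘ punchIn j) (y ∘ punchIn j))) ⟩
    ∑[ j < suc n ] (e j * (dx j + dy j))
      ≈⟨ sum-cong-≋ (λ j → distribˡ (e j) (dx j) (dy j)) ⟩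
    ∑[ j < suc n ] (e j * dx j + e j * dy j)
      ≈⟨ ∑-distrib-+ (λ j → e j * dx j) (λ j → e j * dy j) ⟩
    ∑[ j < suc n ] (e j * dx j) + ∑[ j < suc n ] (e j * dy j) ∎
    where
    e dx dy : Fin (suc n) → A
    e j = sign (toℕ j) * M zero j
    dx j = detR n (minor j M [ k ]≔ x ∘ punchIn j)
    dy j = detR n (minor j M [ k ]≔ y ∘ punchIn j)

  det-row-* : ∀ n (M : Mat n) k s (x : Fin n → A) →
              detR n (M [ k ]≔ λ b → s * x b) ≈ s * detR n (M [ k ]≔ x)
  det-row-* (suc n) M zero s x = begin
    ∑[ j < suc n ] (sign (toℕ j) * (s * x j) * d j) ≈⟨ sum-cong-≋ (λ j → pull (sign (toℕ j)) s (x j) (d j)) ⟩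
    ∑[ j < suc n ] (s * (sign (toℕ j) * x j * d j)) ≈⟨ *-distribˡ-sum s (λ j → sign (toℕ j) * x j * d j) ⟨
    s * ∑[ j < suc n ] (sign (toℕ j) * x j * d j)   ∎
    where
    d : Fin (suc n) → A
    d j = detR n (minor j M)
    pull : ∀ t s x d → t * (s * x) * d ≈ s * (t * x * d)
    pull = ∙-Solver.solve 4 (λ t s x d → ((t · (s · x)) · d) ∙-Solver.⊜ (s · ((t · x) · d))) refl
  det-row-* (suc n) M (suc k) s x = begin
    ∑[ j < suc n ] (e j * detR n (minor j M [ k ]≔ λ b → s * x (punchIn j b)))
      ≈⟨ sum-cong-≋ (λ j → *-congˡ {e j} (det-row-* n (minor j M) k s (x ∘ punchIn j))) ⟩
    ∑[ j < suc n ] (e j * (s * dx j))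
      ≈⟨ sum-cong-≋ (λ j → x∙yz≈y∙xz (e j) s (dx j)) ⟩
    ∑[ j < suc n ] (s * (e j * dx j))
      ≈⟨ *-distribˡ-sum s (λ j → e j * dx j) ⟨
    s * ∑[ j < suc n ] (e j * dx j) ∎
    where
    e dx : Fin (suc n) → A
    e j = sign (toℕ j) * M zero j
    dx j = detR n (minor j M [ k ]≔ x ∘ punchIn j)
    x∙yz≈y∙xz : ∀ x y z → x * (y * z) ≈ y * (x * z)
    x∙yz≈y∙xz = ∙-Solver.solve 3 (λ x y z → (x · (y · z)) ∙-Solver.⊜ (y · (x · z))) refl

  det-row-0 : ∀ n (M : Mat n) k → detR n (M [ k ]≔ λ _ → 0#) ≈ 0#
  det-row-0 n M k = begin
    detR n (M [ k ]≔ λ _ → 0#)      ≈⟨ det-cong n (≔-cong M k (λ _ → sym (zeroˡ 0#))) ⟩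
    detR n (M [ k ]≔ λ _ → 0# * 0#) ≈⟨ det-row-* n M k 0# (λ _ → 0#) ⟩
    0# * detR n (M [ k ]≔ λ _ → 0#) ≈⟨ zeroˡ _ ⟩
    0#                              ∎

  det-row-∑ : ∀ n (M : Mat n) k p (w : Fin p → A) (V : Fin p → Fin n → A) →
              detR n (M [ k ]≔ λ b → ∑[ i < p ] (w i * V i b)) ≈ ∑[ i < p ] (w i * detR n (M [ k ]≔ V i))
  det-row-∑ n M k zero    w V = det-row-0 n M k
  det-row-∑ n M k (suc p) w V = begin
    detR n (M [ k ]≔ λ b → w zero * V zero b + ∑[ i < p ] (w (suc i) * V (suc i) b))
      ≈⟨ det-row-+ n M k (λ b → w zero * V zero b) (λ b → ∑[ i < p ] (w (suc i) * V (suc i) b)) ⟩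
    detR n (M [ k ]≔ λ b → w zero * V zero b) + detR n (M [ k ]≔ λ b → ∑[ i < p ] (w (suc i) * V (suc i) b))
      ≈⟨ +-cong (det-row-* n M k (w zero) (V zero)) (det-row-∑ n M k p (w ∘ suc) (V ∘ suc)) ⟩
    w zero * detR n (M [ k ]≔ V zero) + ∑[ i < p ] (w (suc i) * detR n (M [ k ]≔ V (suc i))) ∎

  -- Deleting columns j and l of a matrix in either order leaves the same
  -- columns: punchIn j ∘ punchIn (punchOut j≢l) = punchIn l ∘ punchIn (punchOut l≢j).
  punchIn-punchIn-swap : ∀ {n} (j l : Fin (suc (suc n))) (j≢l : j ≢ l) (l≢j : l ≢ j) (b : Fin n) →
                         punchIn j (punchIn (punchOut j≢l) b) ≡ punchIn l (punchIn (punchOut l≢j) b)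
  punchIn-punchIn-swap zero    zero    j≢l l≢j b = ⊥-elim (j≢l ≡.refl)
  punchIn-punchIn-swap zero    (suc l) j≢l l≢j b = ≡.refl
  punchIn-punchIn-swap (suc j) zero    j≢l l≢j b = ≡.refl
  punchIn-punchIn-swap {suc n} (suc j) (suc l) j≢l l≢j zero    = ≡.refl
  punchIn-punchIn-swap {suc n} (suc j) (suc l) j≢l l≢j (suc b) =
    ≡.cong suc (punchIn-punchIn-swap j l (j≢l ∘ ≡.cong suc) (l≢j ∘ ≡.cong suc) b)

  sign-swap : ∀ {n} (j l : Fin (suc (suc n))) (j≢l : j ≢ l) (l≢j : l ≢ j) →
              sign (toℕ j) * sign (toℕ (punchOut j≢l)) ≈ - (sign (toℕ l) * sign (toℕ (punchOut l≢j)))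
  sign-swap zero    zero    j≢l l≢j = ⊥-elim (j≢l ≡.refl)
  sign-swap zero    (suc l) j≢l l≢j = begin
    1# * sign (toℕ l)       ≈⟨ *-identityˡ _ ⟩
    sign (toℕ l)            ≈⟨ ⁻¹-involutive _ ⟨
    - - sign (toℕ l)        ≈⟨ -‿cong (*-identityʳ _) ⟨
    - (- sign (toℕ l) * 1#) ∎
  sign-swap (suc j) zero    j≢l l≢j = trans (*-identityʳ _) (-‿cong (sym (*-identityˡ _)))
  sign-swap {zero}  (suc zero) (suc zero) j≢l l≢j = ⊥-elim (j≢l ≡.refl)
  sign-swap {suc n} (suc j) (suc l) j≢l l≢j = begin
    - sign (toℕ j) * - sign (toℕ (punchOut j≢l′))     ≈⟨ neg*neg _ _ ⟩
    sign (toℕ j) * sign (toℕ (punchOut j≢l′))         ≈⟨ sign-swap j l j≢l′ l≢j′ ⟩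
    - (sign (toℕ l) * sign (toℕ (punchOut l≢j′)))     ≈⟨ -‿cong (neg*neg _ _) ⟨
    - (- sign (toℕ l) * - sign (toℕ (punchOut l≢j′))) ∎
    where
    j≢l′ : j ≢ l
    j≢l′ = j≢l ∘ ≡.cong suc
    l≢j′ : l ≢ j
    l≢j′ = l≢j ∘ ≡.cong suc
    neg*neg : ∀ x y → - x * - y ≈ x * y
    neg*neg x y = begin
      - x * - y   ≈⟨ -‿distribˡ-* x (- y) ⟨
      - (x * - y) ≈⟨ -‿cong (-‿distribʳ-* x y) ⟨
      - - (x * y) ≈⟨ ⁻¹-involutive (x * y) ⟩
      x * y       ∎

  -- Expanding det twice, along its first two rows x and y, writes it as
  -- ∑_{j,l} x_j y_l H j l with an antisymmetric cofactor H; hence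
  -- exchanging x and y negates det.
  module FirstTwoRows {n : ℕ} (rest : Fin n → Fin (suc (suc n)) → A) where

    twoRows : (x y : Fin (suc (suc n)) → A) → Mat (suc (suc n))
    twoRows x y zero          = x
    twoRows x y (suc zero)    = y
    twoRows x y (suc (suc a)) = rest a

    restMinor : Fin (suc (suc n)) → Fin (suc n) → A
    restMinor j t = detR n (λ a b → rest a (punchIn j (punchIn t b)))

    cofactor : (j l : Fin (suc (suc n))) → Dec (j ≡ l) → A
    cofactor j l (yes _)  = 0#
    cofactor j l (no j≢l) = sign (toℕ j) * sign (toℕ (punchOut j≢l)) * restMinor j (punchOut j≢l)

    H : Fin (suc (suc n)) → Fin (suc (suc n)) → A
    H j l = cofactor j l (j ≟F l)

    H-diagonal : ∀ j → H j j ≈ 0#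
    H-diagonal j with j ≟F j
    ... | yes _  = refl
    ... | no j≢j = ⊥-elim (j≢j ≡.refl)

    H-punchIn : ∀ j t → H j (punchIn j t) ≈ sign (toℕ j) * sign (toℕ t) * restMinor j t
    H-punchIn j t with j ≟F punchIn j t
    ... | yes j≡ = ⊥-elim (punchInᵢ≢i j t (≡.sym j≡))
    ... | no j≢  = reflexive (≡.cong (λ t′ → sign (toℕ j) * sign (toℕ t′) * restMinor j t′)
                     (≡.trans (punchOut-cong j ≡.refl) (punchOut-punchIn j)))

    H-antisymmetric : ∀ j l → H l j ≈ - H j l
    H-antisymmetric j l with j ≟F l | l ≟F j
    ... | yes _   | yes _   = sym ε⁻¹≈ε
    ... | yes j≡l | no l≢j  = ⊥-elim (l≢j (≡.sym j≡l))
    ... | no j≢l  | yes l≡j = ⊥-elim (j≢l (≡.sym l≡j))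
    ... | no j≢l  | no l≢j  = begin
      sign (toℕ l) * sign (toℕ (punchOut l≢j)) * restMinor l (punchOut l≢j)
        ≈⟨ *-cong (sign-swap l j l≢j j≢l)
                  (det-cong n (λ a b → reflexive (≡.cong (rest a) (punchIn-punchIn-swap l j l≢j j≢l b)))) ⟩
      - (sign (toℕ j) * sign (toℕ (punchOut j≢l))) * restMinor j (punchOut j≢l)
        ≈⟨ -‿distribˡ-* _ _ ⟨
      - (sign (toℕ j) * sign (toℕ (punchOut j≢l)) * restMinor j (punchOut j≢l)) ∎

    expansion : ∀ x y → detR (suc (suc n)) (twoRows x y) ≈ ∑[ j < suc (suc n) ] ∑[ l < suc (suc n) ] (x j * y l * H j l)
    expansion x y = sum-cong-≋ λ j → begin
      sign (toℕ j) * x j * ∑[ t < suc n ] (sign (toℕ t) * y (punchIn j t) * restMinor j t)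
        ≈⟨ *-distribˡ-sum _ (λ t → sign (toℕ t) * y (punchIn j t) * restMinor j t) ⟩
      ∑[ t < suc n ] (sign (toℕ j) * x j * (sign (toℕ t) * y (punchIn j t) * restMinor j t))
        ≈⟨ sum-cong-≋ (λ t → trans (regroup (sign (toℕ j)) (x j) (sign (toℕ t)) (y (punchIn j t)) (restMinor j t))
                                    (*-congˡ {x j * y (punchIn j t)} (sym (H-punchIn j t)))) ⟩
      ∑[ t < suc n ] (x j * y (punchIn j t) * H j (punchIn j t))
        ≈⟨ +-identityˡ _ ⟨
      0# + ∑[ t < suc n ] (x j * y (punchIn j t) * H j (punchIn j t))
        ≈⟨ +-congʳ (trans (*-congˡ {x j * y j} (H-diagonal j)) (zeroʳ _)) ⟨
      x j * y j * H j j + ∑[ t < suc n ] (x j * y (punchIn j t) * H j (punchIn j t))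
        ≈⟨ sum-remove (λ l → x j * y l * H j l) ⟨
      ∑[ l < suc (suc n) ] (x j * y l * H j l) ∎
      where
      regroup : ∀ s x t y d → s * x * (t * y * d) ≈ x * y * (s * t * d)
      regroup = ∙-Solver.solve 5 (λ s x t y d → ((s · x) · ((t · y) · d)) ∙-Solver.⊜ ((x · y) · ((s · t) · d))) refl

    det-swap : ∀ x y → detR (suc (suc n)) (twoRows x y) ≈ - detR (suc (suc n)) (twoRows y x)
    det-swap x y = begin
      detR N (twoRows x y)                        ≈⟨ expansion x y ⟩
      ∑[ j < N ] ∑[ l < N ] (x j * y l * H j l)   ≈⟨ ∑-comm (λ j l → x j * y l * H j l) ⟩
      ∑[ l < N ] ∑[ j < N ] (x j * y l * H j l)   ≈⟨ sum-cong-≋ (λ l → sum-cong-≋ (λ j → flip l j)) ⟩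
      ∑[ l < N ] ∑[ j < N ] (- (y l * x j * H l j))
        ≈⟨ sum-cong-≋ (λ l → sum-neg (λ j → y l * x j * H l j)) ⟨
      ∑[ l < N ] (- ∑[ j < N ] (y l * x j * H l j))
        ≈⟨ sum-neg (λ l → ∑[ j < N ] (y l * x j * H l j)) ⟨
      - ∑[ l < N ] ∑[ j < N ] (y l * x j * H l j) ≈⟨ -‿cong (expansion y x) ⟨
      - detR N (twoRows y x)                      ∎
      where
      N : ℕ
      N = suc (suc n)
      flip : ∀ l j → x j * y l * H j l ≈ - (y l * x j * H l j)
      flip l j = trans (*-cong (*-comm (x j) (y l)) (H-antisymmetric l j)) (sym (-‿distribʳ-* _ _))

    det-twoRows-equal : ∀ x → detR (suc (suc n)) (twoRows x x) ≈ 0#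
    det-twoRows-equal x = noTwoTorsion _ (trans (+-congˡ (det-swap x x)) (-‿inverseʳ _))

  det-vanishing-minors : ∀ n (M : Mat (suc n)) → (∀ j → detR n (minor j M) ≈ 0#) → detR (suc n) M ≈ 0#
  det-vanishing-minors n M minors≈0 =
    sum-zero _ (λ j → trans (*-congˡ {sign (toℕ j) * M zero j} (minors≈0 j)) (zeroʳ _))

  -- If neither row is
  -- the first, every minor has two equal rows.  If the first row equals
  -- row 1 we are in FirstTwoRows; if it equals a later row, exchanging the
  -- first two rows brings us back to the previous case inside every minor.
  det-first-row-equal : ∀ n (M : Mat (suc n)) b → (∀ j → M zero j ≈ M (suc b) j) → detR (suc n) M ≈ 0#
  det-equal-rows : ∀ n (M : Mat n) a b → a ≢ b → (∀ j → M a j ≈ M b j) → detR n M ≈ 0#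
  det-equal-rows (suc n) M zero    zero    0≢0 _ = ⊥-elim (0≢0 ≡.refl)
  det-equal-rows (suc n) M zero    (suc b) _   eq = det-first-row-equal n M b eq
  det-equal-rows (suc n) M (suc a) zero    _   eq = det-first-row-equal n M a (sym ∘ eq)
  det-equal-rows (suc n) M (suc a) (suc b) a≢b eq = det-vanishing-minors n M λ j →
    det-equal-rows n (minor j M) a b (a≢b ∘ ≡.cong suc) (eq ∘ punchIn j)

  det-first-row-equal (suc n) M zero eq = begin
    detR (suc (suc n)) M                           ≈⟨ det-cong (suc (suc n)) rows ⟩
    detR (suc (suc n)) (twoRows (M zero) (M zero)) ≈⟨ det-twoRows-equal (M zero) ⟩
    0#                                             ∎
    where
    open FirstTwoRows (λ a → M (suc (suc a)))
    rows : ∀ a j → M a j ≈ twoRows (M zero) (M zero) a j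
    rows zero          j = refl
    rows (suc zero)    j = sym (eq j)
    rows (suc (suc a)) j = refl
  det-first-row-equal (suc n) M (suc b) eq = begin
    detR (suc (suc n)) M                                 ≈⟨ det-cong (suc (suc n)) rows ⟩
    detR (suc (suc n)) (twoRows (M zero) (M (suc zero))) ≈⟨ det-swap (M zero) (M (suc zero)) ⟩
    - detR (suc (suc n)) (twoRows (M (suc zero)) (M zero))
      ≈⟨ -‿cong (det-vanishing-minors (suc n) (twoRows (M (suc zero)) (M zero)) λ j →
           det-first-row-equal n (minor j (twoRows (M (suc zero)) (M zero))) b (eq ∘ punchIn j)) ⟩
    - 0#                                                 ≈⟨ ε⁻¹≈ε ⟩
    0#                                                   ∎
    where
    open FirstTwoRows (λ a → M (suc (suc a)))
    rows : ∀ a j → M a j ≈ twoRows (M zero) (M (suc zero)) a j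
    rows zero          j = refl
    rows (suc zero)    j = refl
    rows (suc (suc a)) j = refl

  -- Adding to row r a combination of the other rows does not change det:
  -- by linearity the change is ∑_b w b · det (M with row r replaced by row b),
  -- and each of these has two equal rows (or coefficient w r = 0).
  det-add-to-row : ∀ n (M : Mat n) r (w : Fin n → A) → w r ≈ 0# →
                   detR n (M [ r ]≔ λ j → M r j + ∑[ b < n ] (w b * M b j)) ≈ detR n M
  det-add-to-row n M r w wr≈0 = begin
    detR n (M [ r ]≔ λ j → M r j + ∑[ b < n ] (w b * M b j))
      ≈⟨ det-row-+ n M r (M r) (λ j → ∑[ b < n ] (w b * M b j)) ⟩
    detR n (M [ r ]≔ M r) + detR n (M [ r ]≔ λ j → ∑[ b < n ] (w b * M b j))
      ≈⟨ +-cong (det-cong n unchanged) (det-row-∑ n M r n w M) ⟩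
    detR n M + ∑[ b < n ] (w b * detR n (M [ r ]≔ M b))
      ≈⟨ +-congˡ (sum-zero _ vanishing) ⟩
    detR n M + 0#
      ≈⟨ +-identityʳ _ ⟩
    detR n M ∎
    where
    unchanged : ∀ a j → (M [ r ]≔ M r) a j ≈ M a j
    unchanged a j with a ≟F r
    ... | yes ≡.refl = refl
    ... | no _       = refl
    vanishing : ∀ b → w b * detR n (M [ r ]≔ M b) ≈ 0#
    vanishing b with b ≟F r
    ... | yes ≡.refl = trans (*-congʳ wr≈0) (zeroˡ _)
    ... | no b≢r     = trans (*-congˡ {w b} (det-equal-rows n (M [ r ]≔ M b) r b (b≢r ∘ ≡.sym) equal)) (zeroʳ _)
      where
      equal : ∀ j → (M [ r ]≔ M b) r j ≈ (M [ r ]≔ M b) b j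
      equal j = reflexive (≡.trans (≔-here M r (M b) j) (≡.sym (≔-there M r (M b) j b≢r)))

  -- The proof changes the rows one at a time, in the order of their index.
  module SimultaneousRowAddition
    (n : ℕ) (M M′ : Mat n) (w : Fin n → Fin n → A)
    (M′≈ : ∀ a j → M′ a j ≈ M a j + ∑[ b < n ] (w a b * M b j))
    (w-diagonal : ∀ a → w a a ≈ 0#)
    (sources-fixed : ∀ a b → w a b ≈ 0# ⊎ (∀ j → M′ b j ≈ M b j)) where

    row : ∀ {P : Set} → Dec P → Fin n → Fin n → A
    row (yes _) a = M′ a
    row (no _)  a = M a

    upTo : ℕ → Mat n
    upTo t a = row (toℕ a <? t) a

    upTo-below : ∀ t a j → toℕ a < t → upTo t a j ≡ M′ a j
    upTo-below t a j a<t with toℕ a <? t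
    ... | yes _   = ≡.refl
    ... | no  a≮t = ⊥-elim (a≮t a<t)

    upTo-above : ∀ t a j → ¬ (toℕ a < t) → upTo t a j ≡ M a j
    upTo-above t a j a≮t with toℕ a <? t
    ... | yes a<t = ⊥-elim (a≮t a<t)
    ... | no  _   = ≡.refl

    upTo-source : ∀ t a j → (∀ j → M′ a j ≈ M a j) → upTo t a j ≈ M a j
    upTo-source t a j fixed with toℕ a <? t
    ... | yes _ = fixed j
    ... | no  _ = refl

    upTo-suc : ∀ t r → toℕ r ≡ t → ∀ a j → upTo (suc t) a j ≈ (upTo t [ r ]≔ M′ r) a j
    upTo-suc t r r≡t a j with a ≟F r
    ... | yes ≡.refl = reflexive (upTo-below (suc t) a j (s≤s (≤-reflexive r≡t)))
    ... | no a≢r with toℕ a <? suc t | toℕ a <? t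
    ...   | yes _   | yes _   = refl
    ...   | no  _   | no  _   = refl
    ...   | yes a<1+t | no a≮t = ⊥-elim (a≮t (≤∧≢⇒< (≤-pred a<1+t) (a≢r ∘ λ a≡t → toℕ-injective (≡.trans a≡t (≡.sym r≡t)))))
    ...   | no  a≮1+t | yes a<t = ⊥-elim (a≮1+t (m<n⇒m<1+n a<t))

    det-upTo-suc : ∀ t r → toℕ r ≡ t → detR n (upTo (suc t)) ≈ detR n (upTo t)
    det-upTo-suc t r r≡t = begin
      detR n (upTo (suc t))
        ≈⟨ det-cong n (upTo-suc t r r≡t) ⟩
      detR n (upTo t [ r ]≔ M′ r)
        ≈⟨ det-cong n (≔-cong (upTo t) r new-row) ⟩
      detR n (upTo t [ r ]≔ λ j → upTo t r j + ∑[ b < n ] (w r b * upTo t b j))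
        ≈⟨ det-add-to-row n (upTo t) r (w r) (w-diagonal r) ⟩
      detR n (upTo t) ∎
      where
      r≮t : ¬ (toℕ r < t)
      r≮t = <-irrefl r≡t
      term : ∀ b j → w r b * M b j ≈ w r b * upTo t b j
      term b j with sources-fixed r b
      ... | inj₁ w≈0  = trans (*-congʳ w≈0) (trans (zeroˡ _) (sym (trans (*-congʳ w≈0) (zeroˡ _))))
      ... | inj₂ fixed = *-congˡ {w r b} (sym (upTo-source t b j fixed))
      new-row : ∀ j → M′ r j ≈ upTo t r j + ∑[ b < n ] (w r b * upTo t b j)
      new-row j = trans (M′≈ r j) (+-cong (reflexive (≡.sym (upTo-above t r j r≮t))) (sum-cong-≋ (λ b → term b j)))

    det-upTo : ∀ t → t ≤ n → detR n (upTo t) ≈ detR n M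
    det-upTo zero    _   = det-cong n (λ a j → reflexive (upTo-above zero a j (λ ())))
    det-upTo (suc t) t<n = trans (det-upTo-suc t (Fin.fromℕ< t<n) (toℕ-fromℕ< t<n)) (det-upTo t (<⇒≤ t<n))

    det-simultaneous : detR n M′ ≈ detR n M
    det-simultaneous = trans (det-cong n (λ a j → reflexive (≡.sym (upTo-below n a j (toℕ<n a))))) (det-upTo n ≤-refl)

  open SimultaneousRowAddition using (det-simultaneous) public

  det-scale-rows : ∀ n (f : Fin n → A) (M : Mat n) → detR n (λ a b → f a * M a b) ≈ Π.sum f * detR n M
  det-scale-rows zero    f M = sym (*-identityˡ 1#)
  det-scale-rows (suc n) f M = begin
    ∑[ j < suc n ] (sign (toℕ j) * (f zero * M zero j) * detR n (λ a b → f (suc a) * minor j M a b))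
      ≈⟨ sum-cong-≋ (λ j → *-congˡ {sign (toℕ j) * (f zero * M zero j)} (det-scale-rows n (f ∘ suc) (minor j M))) ⟩
    ∑[ j < suc n ] (sign (toℕ j) * (f zero * M zero j) * (Π.sum (f ∘ suc) * detR n (minor j M)))
      ≈⟨ sum-cong-≋ (λ j → regroup (sign (toℕ j)) (f zero) (M zero j) (Π.sum (f ∘ suc)) (detR n (minor j M))) ⟩
    ∑[ j < suc n ] (Π.sum f * (sign (toℕ j) * M zero j * detR n (minor j M)))
      ≈⟨ *-distribˡ-sum (Π.sum f) (λ j → sign (toℕ j) * M zero j * detR n (minor j M)) ⟨
    Π.sum f * detR (suc n) M ∎
    where
    regroup : ∀ s c m p d → s * (c * m) * (p * d) ≈ (c * p) * (s * m * d)
    regroup = ∙-Solver.solve 5 (λ s c m p d → ((s · (c · m)) · (p · d)) ∙-Solver.⊜ ((c · p) · ((s · m) · d))) refl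

  det-diagonal : ∀ n (M : Mat n) → (∀ i j → i ≢ j → M i j ≈ 0#) → detR n M ≈ Π.sum (λ i → M i i)
  det-diagonal zero    M off≈0 = refl
  det-diagonal (suc n) M off≈0 = begin
    detR (suc n) M                                ≈⟨ sum-single _ zero off-terms ⟩
    1# * M zero zero * detR n (minor zero M)      ≈⟨ *-cong (*-identityˡ _) (det-diagonal n (minor zero M) off-minor) ⟩
    M zero zero * Π.sum (λ i → M (suc i) (suc i)) ∎
    where
    off-terms : ∀ j → j ≢ zero → sign (toℕ j) * M zero j * detR n (minor j M) ≈ 0#
    off-terms j j≢0 = trans (*-congʳ (trans (*-congˡ {sign (toℕ j)} (off≈0 zero j (j≢0 ∘ ≡.sym))) (zeroʳ _))) (zeroˡ _)
    off-minor : ∀ i j → i ≢ j → minor zero M i j ≈ 0#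
    off-minor i j i≢j = off≈0 (suc i) (suc j) (i≢j ∘ suc-injective)

  det-block-triangular : ∀ n m (M : Mat (n ℕ.+ m)) → (∀ i e → M (i ↑ˡ m) (n ↑ʳ e) ≈ 0#) →
    detR (n ℕ.+ m) M ≈ detR n (λ i j → M (i ↑ˡ m) (j ↑ˡ m)) * detR m (λ e f → M (n ↑ʳ e) (n ↑ʳ f))
  det-block-triangular zero    m M upper≈0 = sym (*-identityˡ _)
  det-block-triangular (suc n) m M upper≈0 = begin
    detR (suc n ℕ.+ m) M
      ≈⟨ sum-split (suc n) term ⟩
    ∑[ i < suc n ] term (i ↑ˡ m) + ∑[ e < m ] term (suc n ↑ʳ e)
      ≈⟨ +-congˡ (sum-zero _ (λ e → trans (*-congʳ (trans (*-congˡ {sign (toℕ (suc n ↑ʳ e))} (upper≈0 zero e)) (zeroʳ _))) (zeroˡ _))) ⟩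
    ∑[ i < suc n ] term (i ↑ˡ m) + 0#
      ≈⟨ +-identityʳ _ ⟩
    ∑[ i < suc n ] term (i ↑ˡ m)
      ≈⟨ sum-cong-≋ (λ i → trans (*-cong (*-congʳ {M zero (i ↑ˡ m)} (reflexive (≡.cong sign (toℕ-↑ˡ i m)))) (minor-blocks i)) (sym (*-assoc _ _ _))) ⟩
    ∑[ i < suc n ] (sign (toℕ i) * P zero i * detR n (minor i P) * detR m E)
      ≈⟨ *-distribʳ-sum (detR m E) (λ i → sign (toℕ i) * P zero i * detR n (minor i P)) ⟨
    detR (suc n) P * detR m E ∎
    where
    term : Fin (suc n ℕ.+ m) → A
    term j = sign (toℕ j) * M zero j * detR (n ℕ.+ m) (minor j M)
    P : Mat (suc n)
    P i j = M (i ↑ˡ m) (j ↑ˡ m)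
    E : Mat m
    E e f = M (suc n ↑ʳ e) (suc n ↑ʳ f)
    punchIn-↑ˡ : ∀ {k} (j : Fin (suc k)) (b : Fin k) → punchIn (j ↑ˡ m) (b ↑ˡ m) ≡ punchIn j b ↑ˡ m
    punchIn-↑ˡ zero    b       = ≡.refl
    punchIn-↑ˡ (suc j) zero    = ≡.refl
    punchIn-↑ˡ (suc j) (suc b) = ≡.cong suc (punchIn-↑ˡ j b)
    punchIn-↑ʳ : ∀ {k} (j : Fin (suc k)) (e : Fin m) → punchIn (j ↑ˡ m) (k ↑ʳ e) ≡ suc k ↑ʳ e
    punchIn-↑ʳ         zero    e = ≡.refl
    punchIn-↑ʳ {suc k} (suc j) e = ≡.cong suc (punchIn-↑ʳ j e)
    minor-blocks : ∀ i → detR (n ℕ.+ m) (minor (i ↑ˡ m) M) ≈ detR n (minor i P) * detR m E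
    minor-blocks i = trans
      (det-block-triangular n m (minor (i ↑ˡ m) M)
        (λ a e → trans (reflexive (≡.cong (M (suc a ↑ˡ m)) (punchIn-↑ʳ i e))) (upper≈0 (suc a) e)))
      (*-cong (det-cong n (λ a b → reflexive (≡.cong (M (suc a ↑ˡ m)) (punchIn-↑ˡ i b))))
              (det-cong m (λ e f → reflexive (≡.cong (M (suc n ↑ʳ e)) (punchIn-↑ʳ i f)))))

  ⊎-matrix : ∀ n {m} → (Fin n ⊎ Fin m → Fin n ⊎ Fin m → A) → Mat (n ℕ.+ m)
  ⊎-matrix n F i j = F (splitAt n i) (splitAt n j)

  sum-⊎ : ∀ n {m} (g : Fin n ⊎ Fin m → A) →
          ∑[ b < n ℕ.+ m ] g (splitAt n b) ≈ ∑[ u < n ] g (inj₁ u) + ∑[ e < m ] g (inj₂ e)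
  sum-⊎ n {m} g = trans (sum-split n (g ∘ splitAt n))
    (+-cong (sum-cong-≋ (λ u → reflexive (≡.cong g (splitAt-↑ˡ n u m))))
            (sum-cong-≋ (λ e → reflexive (≡.cong g (splitAt-↑ʳ n m e)))))

  product-⊎ : ∀ n {m} (g : Fin n ⊎ Fin m → A) →
              Π.sum (g ∘ splitAt n) ≈ Π.sum (g ∘ inj₁) * Π.sum (g ∘ inj₂ {B = Fin m})
  product-⊎ n {m} g = trans (Π.sum-split n (g ∘ splitAt n))
    (*-cong (Π.sum-cong-≋ (λ u → reflexive (≡.cong g (splitAt-↑ˡ n u m))))
            (Π.sum-cong-≋ (λ e → reflexive (≡.cong g (splitAt-↑ʳ n m e)))))

  scalar : ∀ {m} → A → Mat m
  scalar x e f = if does (e ≟F f) then x else 0#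

  scalar-diagonal : ∀ {m} x (e : Fin m) → scalar x e e ≈ x
  scalar-diagonal x e = reflexive (≡.cong (λ same → if same then x else 0#) (dec-true (e ≟F e) ≡.refl))

  scalar-off-diagonal : ∀ {m} x (e f : Fin m) → e ≢ f → scalar x e f ≈ 0#
  scalar-off-diagonal x e f e≢f = reflexive (≡.cong (λ same → if same then x else 0#) (dec-false (e ≟F f) e≢f))

  det-scalar : ∀ m x → detR m (scalar x) ≈ x ^ m
  det-scalar m x = begin
    detR m (scalar x)                    ≈⟨ det-diagonal m (scalar x) (scalar-off-diagonal {m} x) ⟩
    Π.sum (λ (e : Fin m) → scalar x e e) ≈⟨ Π.sum-cong-≋ (scalar-diagonal {m} x) ⟩
    Π.sum (λ (_ : Fin m) → x)            ≈⟨ Π.sum-replicate m ⟩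
    x ^ m                                ∎

  blocks : ∀ {n m} (P : Mat n) (Q : Fin n → Fin m → A) (C : Fin m → Fin n → A) (x : A) →
           Fin n ⊎ Fin m → Fin n ⊎ Fin m → A
  blocks P Q C x (inj₁ u) (inj₁ v) = P u v
  blocks P Q C x (inj₁ u) (inj₂ f) = Q u f
  blocks P Q C x (inj₂ e) (inj₁ v) = C e v
  blocks P Q C x (inj₂ e) (inj₂ f) = scalar x e f

  -- Multiply the first n rows by x, then subtract Q u e times row e of the
  -- lower block from row u; this clears Q and leaves a block triangular matrix.
  det-schur : ∀ n m (P : Mat n) (Q : Fin n → Fin m → A) (C : Fin m → Fin n → A) x →
    x ^ n * detR (n ℕ.+ m) (⊎-matrix n (blocks P Q C x))
      ≈ detR n (λ u v → x * P u v - ∑[ e < m ] (Q u e * C e v)) * x ^ m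
  det-schur n m P Q C x = begin
    x ^ n * detR (n ℕ.+ m) (⊎-matrix n T)
      ≈⟨ *-congʳ weights-product ⟨
    Π.sum (weight ∘ splitAt n) * detR (n ℕ.+ m) (⊎-matrix n T)
      ≈⟨ det-scale-rows (n ℕ.+ m) (weight ∘ splitAt n) (⊎-matrix n T) ⟨
    detR (n ℕ.+ m) (⊎-matrix n scaled)
      ≈⟨ row-operations ⟨
    detR (n ℕ.+ m) (⊎-matrix n reduced)
      ≈⟨ det-block-triangular n m (⊎-matrix n reduced) upper≈0 ⟩
    detR n (λ u v → ⊎-matrix n reduced (u ↑ˡ m) (v ↑ˡ m)) * detR m (λ e f → ⊎-matrix n reduced (n ↑ʳ e) (n ↑ʳ f))
      ≈⟨ *-cong (det-cong n (λ u v → reflexive (entry (inj₁ u) (inj₁ v))))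
                (trans (det-cong m (λ e f → reflexive (entry (inj₂ e) (inj₂ f)))) (det-scalar m x)) ⟩
    detR n (λ u v → x * P u v - ∑[ e < m ] (Q u e * C e v)) * x ^ m ∎
    where
    S : Set
    S = Fin n ⊎ Fin m
    T : S → S → A
    T = blocks P Q C x
    weight : S → A
    weight (inj₁ _) = x
    weight (inj₂ _) = 1#
    scaled : S → S → A
    scaled s t = weight s * T s t
    reduced : S → S → A
    reduced (inj₁ u) (inj₁ v) = x * P u v - ∑[ e < m ] (Q u e * C e v)
    reduced (inj₁ u) (inj₂ f) = 0#
    reduced (inj₂ e) t        = T (inj₂ e) t
    coefficients : S → S → A
    coefficients (inj₁ u) (inj₂ e) = - Q u e
    coefficients (inj₁ u) (inj₁ v) = 0#
    coefficients (inj₂ e) t        = 0#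

    weights-product : Π.sum (weight ∘ splitAt n) ≈ x ^ n
    weights-product = begin
      Π.sum (weight ∘ splitAt n)                             ≈⟨ product-⊎ n weight ⟩
      Π.sum (λ (_ : Fin n) → x) * Π.sum (λ (_ : Fin m) → 1#) ≈⟨ *-cong (Π.sum-replicate n) (Π.sum-replicate-zero m) ⟩
      x ^ n * 1#                                             ≈⟨ *-identityʳ _ ⟩
      x ^ n                                                  ∎

    entry : ∀ s t → ⊎-matrix n reduced (Fin.join n m s) (Fin.join n m t) ≡ reduced s t
    entry s t = ≡.cong₂ reduced (splitAt-join n m s) (splitAt-join n m t)

    upper≈0 : ∀ u e → ⊎-matrix n reduced (u ↑ˡ m) (n ↑ʳ e) ≈ 0#
    upper≈0 u e = reflexive (entry (inj₁ u) (inj₂ e))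

    lower-rows : ∀ e t → ∑[ b < n ℕ.+ m ] (coefficients (inj₂ e) (splitAt n b) * scaled (splitAt n b) t) ≈ 0#
    lower-rows e t = sum-zero (λ b → 0# * scaled (splitAt n b) t) (λ b → zeroˡ _)

    added : ∀ u t → ∑[ b < n ℕ.+ m ] (coefficients (inj₁ u) (splitAt n b) * scaled (splitAt n b) t)
                      ≈ ∑[ e < m ] (- Q u e * T (inj₂ e) t)
    added u t = begin
      ∑[ b < n ℕ.+ m ] (coefficients (inj₁ u) (splitAt n b) * scaled (splitAt n b) t)
        ≈⟨ sum-⊎ n (λ s → coefficients (inj₁ u) s * scaled s t) ⟩
      ∑[ v < n ] (0# * scaled (inj₁ v) t) + ∑[ e < m ] (- Q u e * (1# * T (inj₂ e) t))
        ≈⟨ +-cong (sum-zero (λ v → 0# * scaled (inj₁ v) t) (λ v → zeroˡ _)) (sum-cong-≋ (λ e → *-congˡ { - Q u e} (*-identityˡ _))) ⟩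
      0# + ∑[ e < m ] (- Q u e * T (inj₂ e) t)
        ≈⟨ +-identityˡ _ ⟩
      ∑[ e < m ] (- Q u e * T (inj₂ e) t) ∎

    reduced≈ : ∀ s t → reduced s t ≈ scaled s t + ∑[ b < n ℕ.+ m ] (coefficients s (splitAt n b) * scaled (splitAt n b) t)
    reduced≈ (inj₂ e) t = sym (trans (+-congˡ (lower-rows e t)) (trans (+-identityʳ _) (*-identityˡ _)))
    reduced≈ (inj₁ u) (inj₁ v) = sym (+-congˡ (begin
      ∑[ b < n ℕ.+ m ] (coefficients (inj₁ u) (splitAt n b) * scaled (splitAt n b) (inj₁ v))
        ≈⟨ added u (inj₁ v) ⟩
      ∑[ e < m ] (- Q u e * C e v)   ≈⟨ sum-cong-≋ (λ e → -‿distribˡ-* (Q u e) (C e v)) ⟨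
      ∑[ e < m ] (- (Q u e * C e v)) ≈⟨ sum-neg (λ e → Q u e * C e v) ⟨
      - ∑[ e < m ] (Q u e * C e v)   ∎))
    reduced≈ (inj₁ u) (inj₂ f) = sym (begin
      x * Q u f + ∑[ b < n ℕ.+ m ] (coefficients (inj₁ u) (splitAt n b) * scaled (splitAt n b) (inj₂ f))
        ≈⟨ +-congˡ (added u (inj₂ f)) ⟩
      x * Q u f + ∑[ e < m ] (- Q u e * scalar x e f)
        ≈⟨ +-congˡ (sum-single _ f (λ e e≢f → trans (*-congˡ { - Q u e} (scalar-off-diagonal x e f e≢f)) (zeroʳ _))) ⟩
      x * Q u f + - Q u f * scalar x f f
        ≈⟨ +-congˡ (*-congˡ { - Q u f} (scalar-diagonal x f)) ⟩
      x * Q u f + - Q u f * x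
        ≈⟨ +-congˡ (trans (-‿cong (*-comm x (Q u f))) (-‿distribˡ-* (Q u f) x)) ⟨
      x * Q u f + - (x * Q u f)
        ≈⟨ -‿inverseʳ _ ⟩
      0# ∎)

    coefficients-diagonal : ∀ s → coefficients s s ≈ 0#
    coefficients-diagonal (inj₁ u) = refl
    coefficients-diagonal (inj₂ e) = refl

    sources : ∀ s t → coefficients s t ≈ 0# ⊎ (∀ t′ → reduced t t′ ≈ scaled t t′)
    sources (inj₁ u) (inj₁ v) = inj₁ refl
    sources (inj₂ e) (inj₁ v) = inj₁ refl
    sources s        (inj₂ e) = inj₂ (λ t′ → sym (*-identityˡ _))

    row-operations : detR (n ℕ.+ m) (⊎-matrix n reduced) ≈ detR (n ℕ.+ m) (⊎-matrix n scaled)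
    row-operations = det-simultaneous (n ℕ.+ m) (⊎-matrix n scaled) (⊎-matrix n reduced) (⊎-matrix n coefficients)
      (λ a j → reduced≈ (splitAt n a) (splitAt n j))
      (λ a → coefficients-diagonal (splitAt n a))
      (λ a b → map₂ (λ fixed j → fixed (splitAt n j)) (sources (splitAt n a) (splitAt n b)))

  det-first-row-column-sums : ∀ k (M : Mat (suc k)) →
    detR (suc k) M ≈ detR (suc k) (M [ zero ]≔ λ v → ∑[ u < suc k ] M u v)
  det-first-row-column-sums k M = sym (trans
    (det-cong (suc k) (≔-cong M zero column-sum))
    (det-add-to-row (suc k) M zero w refl))
    where
    w : Fin (suc k) → A
    w zero    = 0#
    w (suc _) = 1#
    column-sum : ∀ v → ∑[ u < suc k ] M u v ≈ M zero v + ∑[ b < suc k ] (w b * M b v)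
    column-sum v = +-congˡ (sym (trans (+-cong (zeroˡ _) (sum-cong-≋ (λ b → *-identityˡ (M (suc b) v)))) (+-identityˡ _)))

  det-constant-column-sums : ∀ k (M : Mat (suc k)) t → (∀ v → ∑[ u < suc k ] M u v ≈ t) →
    detR (suc k) M ≈ t * detR (suc k) (M [ zero ]≔ λ _ → 1#)
  det-constant-column-sums k M t sums≈t = begin
    detR (suc k) M                                        ≈⟨ det-first-row-column-sums k M ⟩
    detR (suc k) (M [ zero ]≔ λ v → ∑[ u < suc k ] M u v) ≈⟨ det-cong (suc k) (≔-cong M zero (λ v → trans (sums≈t v) (sym (*-identityʳ t)))) ⟩
    detR (suc k) (M [ zero ]≔ λ _ → t * 1#)               ≈⟨ det-row-* (suc k) M zero t (λ _ → 1#) ⟩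
    t * detR (suc k) (M [ zero ]≔ λ _ → 1#)               ∎

  -- Both sides reduce to det V, V being B with its first row replaced by 1s.
  det-rank-one : ∀ k (B : Mat (suc k)) s x c → (∀ v → ∑[ u < suc k ] B u v ≈ s) →
    s * detR (suc k) (λ u v → x * B u v - c) ≈ x ^ k * ((x * s - ∑[ u < suc k ] c) * detR (suc k) B)
  det-rank-one k B s x c sums≈s = begin
    s * detR K Q                 ≈⟨ *-congˡ {s} (det-constant-column-sums k Q γ Q-sums) ⟩
    s * (γ * detR K Q₁)          ≈⟨ *-congˡ {s} (*-congˡ {γ} (det-simultaneous K xB₁ Q₁ w Q₁≈ w-diagonal sources)) ⟩
    s * (γ * detR K xB₁)         ≈⟨ *-congˡ {s} (*-congˡ {γ} det-xB₁) ⟩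
    s * (γ * (x ^ k * detR K V)) ≈⟨ regroup s γ (x ^ k) (detR K V) ⟩
    x ^ k * (γ * (s * detR K V)) ≈⟨ *-congˡ {x ^ k} (*-congˡ {γ} (det-constant-column-sums k B s sums≈s)) ⟨
    x ^ k * (γ * detR K B)       ∎
    where
    K : ℕ
    K = suc k
    one : Fin K → A
    one _ = 1#
    γ : A
    γ = x * s - ∑[ u < K ] c
    Q Q₁ V xB₁ : Mat K
    Q u v = x * B u v - c
    Q₁ = Q [ zero ]≔ one
    V = B [ zero ]≔ one
    xB₁ = (λ u v → x * B u v) [ zero ]≔ one

    Q-sums : ∀ v → ∑[ u < K ] Q u v ≈ γ
    Q-sums v = begin
      ∑[ u < K ] (x * B u v + - c)
        ≈⟨ ∑-distrib-+ (λ u → x * B u v) (λ _ → - c) ⟩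
      ∑[ u < K ] (x * B u v) + ∑[ u < K ] (- c)
        ≈⟨ +-cong (trans (sym (*-distribˡ-sum x (λ u → B u v))) (*-congˡ {x} (sums≈s v)))
                  (sym (sum-neg (λ (_ : Fin K) → c))) ⟩
      x * s - ∑[ u < K ] c ∎

    -- subtract c times the first row (now 1, …, 1) from every other row
    w : Fin K → Fin K → A
    w (suc _) zero = - c
    w _       _    = 0#
    w-diagonal : ∀ a → w a a ≈ 0#
    w-diagonal zero    = refl
    w-diagonal (suc a) = refl
    Q₁≈ : ∀ a j → Q₁ a j ≈ xB₁ a j + ∑[ b < K ] (w a b * xB₁ b j)
    Q₁≈ zero    j = sym (trans (+-congˡ (sum-zero (λ b → 0# * xB₁ b j) (λ b → zeroˡ _))) (+-identityʳ _))
    Q₁≈ (suc a) j = +-congˡ (sym (begin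
      - c * 1# + ∑[ b < k ] (0# * xB₁ (suc b) j) ≈⟨ +-cong (*-identityʳ _) (sum-zero (λ b → 0# * xB₁ (suc b) j) (λ b → zeroˡ _)) ⟩
      - c + 0#                                   ≈⟨ +-identityʳ _ ⟩
      - c                                        ∎))
    sources : ∀ a b → w a b ≈ 0# ⊎ (∀ j → Q₁ b j ≈ xB₁ b j)
    sources zero    _       = inj₁ refl
    sources (suc a) (suc b) = inj₁ refl
    sources (suc a) zero    = inj₂ (λ j → refl)

    det-xB₁ : detR K xB₁ ≈ x ^ k * detR K V
    det-xB₁ = begin
      detR K xB₁                   ≈⟨ det-cong K scaled-rows ⟩
      detR K (λ a b → f a * V a b) ≈⟨ det-scale-rows K f V ⟩
      Π.sum f * detR K V           ≈⟨ *-congʳ (trans (*-identityˡ _) (Π.sum-replicate k)) ⟩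
      x ^ k * detR K V             ∎
      where
      f : Fin K → A
      f zero    = 1#
      f (suc _) = x
      scaled-rows : ∀ a b → xB₁ a b ≈ f a * V a b
      scaled-rows zero    b = sym (*-identityˡ 1#)
      scaled-rows (suc a) b = refl
    regroup : ∀ s γ p d → s * (γ * (p * d)) ≈ p * (γ * (s * d))
    regroup = ∙-Solver.solve 4 (λ s γ p d → (s · (γ · (p · d))) ∙-Solver.⊜ (p · (γ · (s · d)))) refl

  bordered : ∀ {n m} → Mat n → A → Fin n ⊎ Fin m → Fin n ⊎ Fin m → A
  bordered B x = blocks B (λ _ _ → - 1#) (λ _ _ → - 1#) x

  det-bordered : ∀ n m (B : Mat n) s x → 1 ≤ n → (∀ v → ∑[ u < n ] B u v ≈ s) →
    x ^ n * (x * s * detR (n ℕ.+ m) (⊎-matrix n (bordered B x)))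
      ≈ x ^ n * (x ^ m * (x * s - ∑[ u < n ] ∑[ e < m ] (- 1# * - 1#)) * detR n B)
  det-bordered (suc k) m B s x _ sums≈s = begin
    x ^ n * (x * s * detR (n ℕ.+ m) (⊎-matrix n (bordered B x)))
      ≈⟨ regroup₁ (x ^ n) x s _ ⟩
    x * s * (x ^ n * detR (n ℕ.+ m) (⊎-matrix n (bordered B x)))
      ≈⟨ *-congˡ {x * s} (det-schur n m B (λ _ _ → - 1#) (λ _ _ → - 1#) x) ⟩
    x * s * (detR n (λ u v → x * B u v - c) * x ^ m)
      ≈⟨ regroup₂ x s _ (x ^ m) ⟩
    x ^ m * (x * (s * detR n (λ u v → x * B u v - c)))
      ≈⟨ *-congˡ {x ^ m} (*-congˡ {x} (det-rank-one k B s x c sums≈s)) ⟩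
    x ^ m * (x * (x ^ k * ((x * s - ∑[ u < n ] c) * detR n B)))
      ≈⟨ regroup₃ (x ^ m) x (x ^ k) _ _ ⟩
    x ^ n * (x ^ m * (x * s - ∑[ u < n ] c) * detR n B) ∎
    where
    n : ℕ
    n = suc k
    c : A
    c = ∑[ e < m ] (- 1# * - 1#)
    regroup₁ : ∀ p x s d → p * (x * s * d) ≈ x * s * (p * d)
    regroup₁ = ∙-Solver.solve 4 (λ p x s d → (p · ((x · s) · d)) ∙-Solver.⊜ ((x · s) · (p · d))) refl
    regroup₂ : ∀ x s d p → x * s * (d * p) ≈ p * (x * (s * d))
    regroup₂ = ∙-Solver.solve 4 (λ x s d p → ((x · s) · (d · p)) ∙-Solver.⊜ (p · (x · (s · d)))) refl
    regroup₃ : ∀ p x q γ d → p * (x * (q * (γ * d))) ≈ x * q * (p * γ * d)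
    regroup₃ = ∙-Solver.solve 5 (λ p x q γ d → (p · (x · (q · (γ · d)))) ∙-Solver.⊜ ((x · q) · ((p · γ) · d))) refl

module Counting where

  open ≡ using (refl; sym; trans; cong; cong₂; module ≡-Reasoning)

  module ℕΣ = FinSums ℕP.+-0-commutativeMonoid

  count-cong : ∀ k {P Q : Fin k → Bool} → (∀ i → P i ≡ Q i) → count k P ≡ count k Q
  count-cong zero    P≡Q = refl
  count-cong (suc k) P≡Q = cong₂ (λ b c → (if b then 1 else 0) ℕ.+ c) (P≡Q zero) (count-cong k (P≡Q ∘ suc))

  count-none : ∀ k (P : Fin k → Bool) → (∀ i → P i ≡ false) → count k P ≡ 0
  count-none zero    P none = refl
  count-none (suc k) P none rewrite none zero = count-none k (P ∘ suc) (none ∘ suc)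

  count-single : ∀ k (j : Fin k) → count k (λ i → does (i ≟F j)) ≡ 1
  count-single (suc k) zero    = cong suc (count-none k _ (λ i → refl))
  count-single (suc k) (suc j) = count-single k j

  count-split : ∀ a b (P : Fin (a ℕ.+ b) → Bool) →
                count (a ℕ.+ b) P ≡ count a (λ i → P (i ↑ˡ b)) ℕ.+ count b (λ j → P (a ↑ʳ j))
  count-split zero    b P = refl
  count-split (suc a) b P = trans (cong ((if P zero then 1 else 0) ℕ.+_) (count-split a b (P ∘ suc)))
                                  (sym (ℕP.+-assoc (if P zero then 1 else 0) _ _))

  count≡sum : ∀ k (P : Fin k → Bool) → count k P ≡ ℕΣ.sum (λ i → if P i then 1 else 0)
  count≡sum zero    P = refl
  count≡sum (suc k) P = cong ((if P zero then 1 else 0) ℕ.+_) (count≡sum k (P ∘ suc))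

  ℕΣ-constant : ∀ n a → ℕΣ.sum (λ (_ : Fin n) → a) ≡ n ℕ.* a
  ℕΣ-constant zero    a = refl
  ℕΣ-constant (suc n) a = cong (a ℕ.+_) (ℕΣ-constant n a)

  in-degree : ∀ n m (tl hd : Fin m → Fin n) v →
    ℕΣ.sum (λ u → count m (λ e → does (tl e ≟F u) ∧ does (hd e ≟F v))) ≡ count m (λ e → does (hd e ≟F v))
  in-degree n m tl hd v = begin
    ℕΣ.sum (λ u → count m (λ e → does (tl e ≟F u) ∧ does (hd e ≟F v)))
      ≡⟨ ℕΣ.sum-cong-≋ (λ u → count≡sum m (λ e → does (tl e ≟F u) ∧ does (hd e ≟F v))) ⟩
    ℕΣ.sum (λ u → ℕΣ.sum (λ e → indicator e u))
      ≡⟨ ℕΣ.∑-comm (λ u e → indicator e u) ⟩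
    ℕΣ.sum (λ e → ℕΣ.sum (indicator e))
      ≡⟨ ℕΣ.sum-cong-≋ (λ e → trans (ℕΣ.sum-single (indicator e) (tl e) (off-tail e)) (at-tail e)) ⟩
    ℕΣ.sum (λ e → if does (hd e ≟F v) then 1 else 0)
      ≡⟨ count≡sum m (λ e → does (hd e ≟F v)) ⟨
    count m (λ e → does (hd e ≟F v)) ∎
    where
    open ≡-Reasoning
    indicator : Fin m → Fin n → ℕ
    indicator e u = if does (tl e ≟F u) ∧ does (hd e ≟F v) then 1 else 0
    off-tail : ∀ e u → u ≢ tl e → indicator e u ≡ 0
    off-tail e u u≢tl rewrite dec-false (tl e ≟F u) (u≢tl ∘ sym) = refl
    at-tail : ∀ e → indicator e (tl e) ≡ (if does (hd e ≟F v) then 1 else 0)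
    at-tail e rewrite dec-true (tl e ≟F tl e) refl = refl

-- The vertices of D^{+01} are V ⊎ E, encoded in Fin (n + m) by join.
module Plus01 (D : Digraph) where

  open ≡ using (refl; sym; trans; cong; cong₂)

  open Digraph D
  open Counting

  V⊎E : Set
  V⊎E = Fin n ⊎ Fin m

  _≟⊎_ : DecidableEquality V⊎E
  _≟⊎_ = ≡-dec _≟F_ _≟F_

  does-injective : ∀ {A B : Set} (_≟A_ : DecidableEquality A) (_≟B_ : DecidableEquality B)
    (f : A → B) → (∀ {x y} → f x ≡ f y → x ≡ y) → ∀ x y → does (f x ≟B f y) ≡ does (x ≟A y)
  does-injective _≟A_ _≟B_ f f-injective x y with x ≟A y
  ... | yes refl = dec-true (f x ≟B f x) refl
  ... | no  x≢y  = dec-false (f x ≟B f y) (x≢y ∘ f-injective)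

  does-join : ∀ s t → does (join n m s ≟F join n m t) ≡ does (s ≟⊎ t)
  does-join = does-injective _≟⊎_ _≟F_ (join n m)
    (λ {s} {t} eq → trans (sym (splitAt-join n m s)) (trans (cong (splitAt n) eq) (splitAt-join n m t)))

  -- The arcs (v, e) and (e, v) of D^{+01} are indexed by c : Fin (n * m),
  -- standing for the pair remQuot c = (vertexOf c , arcOf c).
  vertexOf : Fin (n ℕ.* m) → Fin n
  vertexOf c = proj₁ (remQuot {n} m c)

  arcOf : Fin (n ℕ.* m) → Fin m
  arcOf c = proj₂ (remQuot {n} m c)

  joins : V⊎E × V⊎E → V⊎E → V⊎E → Bool
  joins (x , y) s t = does (x ≟⊎ s) ∧ does (y ≟⊎ t)

  remQuot-hits : ∀ (c : Fin (n ℕ.* m)) u f →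
    does (vertexOf c ≟F u) ∧ does (arcOf c ≟F f) ≡ does (c ≟F combine {n} {m} u f)
  remQuot-hits c u f with c ≟F combine {n} {m} u f
  ... | yes refl = pair-hits (remQuot {n} m (combine {n} {m} u f)) (remQuot-combine u f)
    where
    pair-hits : ∀ p → p ≡ (u , f) → does (proj₁ p ≟F u) ∧ does (proj₂ p ≟F f) ≡ true
    pair-hits _ refl rewrite dec-true (u ≟F u) refl = dec-true (f ≟F f) refl
  ... | no c≢uf with vertexOf c ≟F u | arcOf c ≟F f
  ...   | yes q≡u | yes r≡f = ⊥-elim (c≢uf (trans (sym (combine-remQuot {n} m c)) (cong₂ combine q≡u r≡f)))
  ...   | yes _   | no  _   = refl
  ...   | no  _   | _       = refl

  ψ⁺ : Fin (m ℕ.+ (n ℕ.* m ℕ.+ n ℕ.* m)) → Fin (n ℕ.+ m) × Fin (n ℕ.+ m)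
  ψ⁺ = Digraph.ψ (plus01 D)

  arc-endpoints : V⊎E → V⊎E → Fin (n ℕ.+ m) × Fin (n ℕ.+ m)
  arc-endpoints x y = join n m x , join n m y

  ψ⁺-arc : ∀ e → ψ⁺ (e ↑ˡ (n ℕ.* m ℕ.+ n ℕ.* m)) ≡ arc-endpoints (inj₁ (tl e)) (inj₁ (hd e))
  ψ⁺-arc e rewrite splitAt-↑ˡ m e (n ℕ.* m ℕ.+ n ℕ.* m) = refl

  ψ⁺-out : ∀ c → ψ⁺ (m ↑ʳ (c ↑ˡ n ℕ.* m)) ≡ arc-endpoints (inj₁ (vertexOf c)) (inj₂ (arcOf c))
  ψ⁺-out c rewrite splitAt-↑ʳ m (n ℕ.* m ℕ.+ n ℕ.* m) (c ↑ˡ n ℕ.* m) | splitAt-↑ˡ (n ℕ.* m) c (n ℕ.* m) = refl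

  ψ⁺-in : ∀ c → ψ⁺ (m ↑ʳ (n ℕ.* m ↑ʳ c)) ≡ arc-endpoints (inj₂ (arcOf c)) (inj₁ (vertexOf c))
  ψ⁺-in c rewrite splitAt-↑ʳ m (n ℕ.* m ℕ.+ n ℕ.* m) (n ℕ.* m ↑ʳ c) | splitAt-↑ʳ (n ℕ.* m) (n ℕ.* m) c = refl

  from-to : V⊎E → V⊎E → ℕ × ℕ × ℕ
  from-to s t =
      count m (λ e → joins (inj₁ (tl e) , inj₁ (hd e)) s t)
    , count (n ℕ.* m) (λ c → joins (inj₁ (vertexOf c) , inj₂ (arcOf c)) s t)
    , count (n ℕ.* m) (λ c → joins (inj₂ (arcOf c) , inj₁ (vertexOf c)) s t)

  total : ℕ × ℕ × ℕ → ℕ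
  total (a , b , c) = a ℕ.+ (b ℕ.+ c)

  adj-families : ∀ s t → adj (plus01 D) (join n m s) (join n m t) ≡ + total (from-to s t)
  adj-families s t = cong +_ (trans (count-split m (n ℕ.* m ℕ.+ n ℕ.* m) arc-joins)
    (cong₂ ℕ._+_ (count-cong m (λ e → family (inj₁ (tl e)) (inj₁ (hd e)) (ψ⁺-arc e)))
      (trans (count-split (n ℕ.* m) (n ℕ.* m) (arc-joins ∘ (m ↑ʳ_)))
        (cong₂ ℕ._+_ (count-cong (n ℕ.* m) (λ c → family (inj₁ (vertexOf c)) (inj₂ (arcOf c)) (ψ⁺-out c)))
                     (count-cong (n ℕ.* m) (λ c → family (inj₂ (arcOf c)) (inj₁ (vertexOf c)) (ψ⁺-in c)))))))
    where
    arc-joins : Fin (m ℕ.+ (n ℕ.* m ℕ.+ n ℕ.* m)) → Bool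
    arc-joins a = does (proj₁ (ψ⁺ a) ≟F join n m s) ∧ does (proj₂ (ψ⁺ a) ≟F join n m t)
    family : ∀ {a} x y → ψ⁺ a ≡ arc-endpoints x y → arc-joins a ≡ joins (x , y) s t
    family x y eq rewrite eq = cong₂ _∧_ (does-join x s) (does-join y t)

  arcs⁺ : V⊎E → V⊎E → ℕ
  arcs⁺ (inj₁ u) (inj₁ v) = count m (λ e → does (tl e ≟F u) ∧ does (hd e ≟F v))
  arcs⁺ (inj₁ u) (inj₂ f) = 1
  arcs⁺ (inj₂ e) (inj₁ v) = 1
  arcs⁺ (inj₂ e) (inj₂ f) = 0

  adj-plus01 : ∀ s t → adj (plus01 D) (join n m s) (join n m t) ≡ + arcs⁺ s t
  adj-plus01 s t = trans (adj-families s t) (cong +_ (families s t))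
    where
    none : ∀ k (P : Fin k → Bool) → count k (λ i → P i ∧ false) ≡ 0
    none k P = count-none k _ (λ i → ∧-zeroʳ (P i))
    single : ∀ u f → count (n ℕ.* m) (λ c → does (vertexOf c ≟F u) ∧ does (arcOf c ≟F f)) ≡ 1
    single u f = trans (count-cong (n ℕ.* m) (λ c → remQuot-hits c u f)) (count-single (n ℕ.* m) (combine {n} {m} u f))
    nothing : ∀ k → count k (λ _ → false) ≡ 0
    nothing k = count-none k _ (λ _ → refl)
    add : ∀ {a b c a′ b′ c′} → a ≡ a′ → b ≡ b′ → c ≡ c′ → a ℕ.+ (b ℕ.+ c) ≡ a′ ℕ.+ (b′ ℕ.+ c′)
    add refl refl refl = refl
    families : ∀ s t → total (from-to s t) ≡ arcs⁺ s t
    families (inj₁ u) (inj₁ v) = trans (add {c′ = 0} refl (none _ (λ c → does (vertexOf c ≟F u))) (nothing (n ℕ.* m)))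
                                       (ℕP.+-identityʳ _)
    families (inj₁ u) (inj₂ f) = add (none _ (λ e → does (tl e ≟F u))) (single u f) (nothing (n ℕ.* m))
    families (inj₂ e) (inj₁ v) = add (nothing m) (nothing (n ℕ.* m))
      (trans (count-cong _ (λ c → ∧-comm (does (arcOf c ≟F e)) _)) (single v e))
    families (inj₂ e) (inj₂ f) = add (nothing m) (nothing (n ℕ.* m)) (none _ (λ c → does (arcOf c ≟F e)))

open Polynomials
module ℤ[λ] = Determinants polyRing no-two-torsion
open ℤ[λ] using (Mat; sum; sum-syntax; ⊎-matrix; bordered)
open CommutativeRing polyRing using (_≈_; refl; sym; trans; reflexive; +-cong; +-congˡ; *-cong; *-congˡ; -‿cong; setoid)
open import Relation.Binary.Reasoning.Setoid setoid

sumP≡sum : ∀ k (f : Fin k → Poly) → sumP k f ≡ sum f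
sumP≡sum zero    f = ≡.refl
sumP≡sum (suc k) f = ≡.cong (f zero +P_) (sumP≡sum k (f ∘ suc))

signP≡sign : ∀ i → signP i ≡ ℤ[λ].sign i
signP≡sign zero    = ≡.refl
signP≡sign (suc i) = ≡.cong -P_ (signP≡sign i)

det≡det : ∀ k (M : Fin k → Fin k → Poly) → Defs.det k M ≡ ℤ[λ].detR k M
det≡det zero    M = ≡.refl
det≡det (suc k) M = ≡.trans (sumP≡sum (suc k) (λ j → signP (toℕ j) *P M zero j *P Defs.det k (ℤ[λ].minor j M)))
  (ℤ[λ].sum-cong-≗ λ j → ≡.cong₂ (λ s d → s *P M zero j *P d) (signP≡sign (toℕ j)) (det≡det k (ℤ[λ].minor j M)))

open Counting using (module ℕΣ; ℕΣ-constant; in-degree)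

sum-constP : ∀ n (g : Fin n → ℕ) → ∑[ i < n ] constP (+ g i) ≈ constP (+ ℕΣ.sum g)
sum-constP zero    g = mk≋ λ { zero → ≡.refl ; (suc k) → ≡.refl }
sum-constP (suc n) g = +-congˡ (sum-constP n (g ∘ suc))

module CharacteristicMatrices (D : Digraph) where

  open Digraph D
  open Plus01 D using (V⊎E; _≟⊎_; does-join; arcs⁺; adj-plus01)

  entry : Bool → ℤ.ℤ → Poly
  entry same a = (if same then X else []) +P constP (ℤ.- a)

  charMatrix : Mat n
  charMatrix u v = entry (does (u ≟F v)) (adj D u v)

  charPoly-D : charPoly D ≡ ℤ[λ].detR n charMatrix
  charPoly-D = det≡det n charMatrix

  charMatrix⁺ : ∀ s t → entry (does (join n m s ≟F join n m t)) (adj (plus01 D) (join n m s) (join n m t))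
                          ≈ bordered charMatrix X s t
  charMatrix⁺ s t = trans (reflexive (≡.cong₂ entry (does-join s t) (adj-plus01 s t))) (by-blocks s t)
    where
    by-blocks : ∀ s t → entry (does (s ≟⊎ t)) (+ arcs⁺ s t) ≈ bordered charMatrix X s t
    by-blocks (inj₁ u) (inj₁ v) = refl
    by-blocks (inj₁ u) (inj₂ f) = refl
    by-blocks (inj₂ e) (inj₁ v) = refl
    by-blocks (inj₂ e) (inj₂ f) = mk≋ (+P-constP-0 (if does (e ≟F f) then X else []))

  charPoly-plus01 : charPoly (plus01 D) ≈ ℤ[λ].detR (n ℕ.+ m) (⊎-matrix n (bordered charMatrix X))
  charPoly-plus01 = trans (reflexive (det≡det (n ℕ.+ m) _)) (ℤ[λ].det-cong (n ℕ.+ m) λ i j →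
    trans (reflexive (≡.cong₂ (λ i′ j′ → entry (does (i′ ≟F j′)) (adj (plus01 D) i′ j′))
                              (≡.sym (join-splitAt n m i)) (≡.sym (join-splitAt n m j))))
          (charMatrix⁺ (splitAt n i) (splitAt n j)))

  column-sums : ∀ r → IsRegular D r → ∀ v → ∑[ u < n ] charMatrix u v ≈ X -P constP (+ r)
  column-sums r regular v = begin
    ∑[ u < n ] (δ u +P -P constP (+ a u))
      ≈⟨ ℤ[λ].∑-distrib-+ δ (λ u → -P constP (+ a u)) ⟩
    ∑[ u < n ] δ u +P ∑[ u < n ] (-P constP (+ a u))
      ≈⟨ +-cong (ℤ[λ].sum-single δ v off-diagonal) (sym (ℤ[λ].sum-neg (λ u → constP (+ a u)))) ⟩
    δ v +P -P (∑[ u < n ] constP (+ a u))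
      ≈⟨ +-cong (reflexive (≡.cong (λ b → if b then X else []) (dec-true (v ≟F v) ≡.refl))) (-‿cong (sum-constP n a)) ⟩
    X +P -P constP (+ ℕΣ.sum a)
      ≡⟨ ≡.cong (λ k → X -P constP (+ k)) (≡.trans (in-degree n m tl hd v) (proj₂ (regular v))) ⟩
    X -P constP (+ r) ∎
    where
    δ : Fin n → Poly
    δ u = if does (u ≟F v) then X else []
    a : Fin n → ℕ
    a u = count m (λ e → does (tl e ≟F u) ∧ does (hd e ≟F v))
    off-diagonal : ∀ u → u ≢ v → δ u ≈ []
    off-diagonal u u≢v = reflexive (≡.cong (λ b → if b then X else []) (dec-false (u ≟F v) u≢v))

  quadratic : ∀ r → X *P (X -P constP (+ r)) -P ∑[ u < n ] ∑[ e < m ] constP (+ 1)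
      ≈ (X ^P 2) -P (constP (+ r) *P X) -P constP (+ (m ℕ.* n))
  quadratic r = +-cong product (-‿cong pairs)
    where
    open CommutativeRing polyRing using (distribˡ; *-identityʳ; *-comm)
    open import Algebra.Properties.Ring (CommutativeRing.ring polyRing) using (-‿distribʳ-*)
    ρ : Poly
    ρ = constP (+ r)
    product : X *P (X -P ρ) ≈ (X ^P 2) -P (ρ *P X)
    product = begin
      X *P (X +P -P ρ)      ≈⟨ distribˡ X X (-P ρ) ⟩
      X *P X +P X *P (-P ρ) ≈⟨ +-cong (*-congˡ {X} (sym (*-identityʳ X))) (sym (-‿distribʳ-* X ρ)) ⟩
      X ^P 2 +P -P (X *P ρ) ≈⟨ +-congˡ {X ^P 2} (-‿cong (*-comm X ρ)) ⟩
      X ^P 2 +P -P (ρ *P X) ∎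
    -- each of the n · m pairs (u, e) contributes (-1)(-1) = 1
    pairs : ∑[ u < n ] ∑[ e < m ] constP (+ 1) ≈ constP (+ (m ℕ.* n))
    pairs = begin
      ∑[ u < n ] ∑[ e < m ] constP (+ 1)    ≈⟨ ℤ[λ].sum-cong-≋ {n} (λ _ → sum-constP m (λ _ → 1)) ⟩
      ∑[ u < n ] constP (+ ℕΣ.sum (λ (_ : Fin m) → 1))
        ≡⟨ ≡.cong (λ k → ∑[ u < n ] constP (+ k)) (≡.trans (ℕΣ-constant m 1) (ℕP.*-identityʳ m)) ⟩
      ∑[ u < n ] constP (+ m)               ≈⟨ sum-constP n (λ _ → m) ⟩
      constP (+ ℕΣ.sum (λ (_ : Fin n) → m)) ≡⟨ ≡.cong (λ k → constP (+ k)) (≡.trans (ℕΣ-constant n m) (ℕP.*-comm n m)) ⟩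
      constP (+ (m ℕ.* n))                  ∎

X^P≡^ : ∀ k → X ^P k ≡ X ℤ[λ].^ k
X^P≡^ zero    = ≡.refl
X^P≡^ (suc k) = ≡.cong (X *P_) (X^P≡^ k)

-- Both sides, multiplied by λ^n, are the two sides of det-bordered for
-- B = λI - A(D) and s = λ - r; cancel λ^n.
theorem4p7 : (D : Digraph) (r : ℕ) → IsRegular D r →
    (X *P (X -P constP (+ r))) *P charPoly (plus01 D)
      ≈P (X ^P Digraph.m D) *P
         ((X ^P 2) -P (constP (+ r) *P X) -P constP (+ (Digraph.m D Data.Nat.* Digraph.n D)))
         *P charPoly D
theorem4p7 D r regular = coeffs (X^-cancel n lhs rhs (begin
  X ^P n *P lhs
    ≈⟨ *-cong (reflexive (X^P≡^ n)) (*-congˡ {X *P s} charPoly-plus01) ⟩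
  X ℤ[λ].^ n *P (X *P s *P ℤ[λ].detR (n ℕ.+ m) (⊎-matrix n (bordered charMatrix X)))
    ≈⟨ ℤ[λ].det-bordered n m charMatrix s X nonempty (column-sums r regular) ⟩
  X ℤ[λ].^ n *P (X ℤ[λ].^ m *P (X *P s -P ∑[ u < n ] ∑[ e < m ] constP (+ 1)) *P ℤ[λ].detR n charMatrix)
    ≈⟨ *-cong (reflexive (≡.sym (X^P≡^ n)))
              (*-cong (*-cong (reflexive (≡.sym (X^P≡^ m))) (quadratic r)) (reflexive (≡.sym charPoly-D))) ⟩
  X ^P n *P rhs ∎))
  where
  open Digraph D
  open CharacteristicMatrices D
  s quadratic-factor lhs rhs : Poly
  s = X -P constP (+ r)
  quadratic-factor = (X ^P 2) -P (constP (+ r) *P X) -P constP (+ (m ℕ.* n))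
  lhs = X *P s *P charPoly (plus01 D)
  rhs = (X ^P m) *P quadratic-factor *P charPoly D
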